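{- Let $T$ and $T'$ be two tournaments on the same set $V$ of $v$ vertices. Let $p$ be a prime number and $k$ an integer with $3\leq k\leq v-3$. 1) If $c^{(3)}(T_{\restriction K})=c^{(3)}(T'_{\restriction K})$ for all $k$-element subsets $K$ of $V$, then $T$ and $T'$ are $(\leq 3)$-hypomorphic. 2) Assume $p\geq 5$. If $k\not\equiv 1,2 \pmod p$ and $c^{(3)}(T_{\restriction K})\equiv c^{(3)}(T'_{\restriction K}) \pmod p$ for all $k$-element subsets $K$ of $V$, then $T$ and $T'$ are $(\leq 3)$-hypomorphic. 3) If ($p=2$ and $k\equiv 3\pmod 4$) or ($p=3$ and $3\mid k$), and $c^{(3)}(T_{\restriction K})\equiv c^{(3)}(T'_{\restriction K}) \pmod p$ for all $k$-element subsets $K$ of $V$, then $T$ and $T'$ are $(\leq 3)$-hypomorphic.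
   Context: Tournaments: for distinct vertices $x,y$ exactly one of the arcs $(x,y),(y,x)$ is present. $T_{\restriction K}$ is the induced subtournament on $K$. A $3$-cycle is a tournament isomorphic to $(\{0,1,2\},\{(0,1),(1,2),(2,0)\})$. $c^{(3)}(T)$ is the number of $3$-element vertex subsets inducing a $3$-cycle in $T$. Tournaments $T,T'$ on the same set $V$ are $h$-hypomorphic if for every $h$-element subset $K$ of $V$, $T_{\restriction K}$ and $T'_{\restriction K}$ are isomorphic; they are $(\leq k)$-hypomorphic if they are $h$-hypomorphic for every $h\leq k$. -}

module Defs where

open import Data.Nat using (ℕ; zero; suc; _<_; _≤_)
open import Data.Bool using (Bool; true; false; not; _∧_; _∨_; if_then_else_)
open import Data.Fin using (Fin; toℕ)
open import Data.Fin.Subset using (Subset; _∈_; ∣_∣)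
open import Data.Integer using (ℤ; +_; _-_)
open import Data.Integer.Divisibility using () renaming (_∣_ to _∣ℤ_)
open import Data.Product using (Σ; _×_; ∃)
open import Relation.Binary.PropositionalEquality using (_≡_; _≢_)
open import Relation.Nullary using (¬_)
open import Data.List using (List; []; _∷_; length; filter; allFin; concatMap)
open import Data.Fin.Properties using (_<?_)
open import Relation.Nullary.Decidable using (⌊_⌋)

record Tournament (v : ℕ) : Set where
  field
    arc    : Fin v → Fin v → Bool
    irrefl : ∀ x → arc x x ≡ false
    total  : ∀ x y → x ≢ y → arc y x ≡ not (arc x y)
open Tournament public

-- Isomorphism of the induced subtournaments T|K and T'|K :
-- a map f sending K into K, injective on K (hence a bijection of the
-- finite set K onto itself), preserving and reflecting arcs.
InducedIso : ∀ {v} → Tournament v → Tournament v → Subset v → Set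
InducedIso {v} T T' K =
  Σ (Fin v → Fin v) λ f →
    (∀ x → x ∈ K → f x ∈ K) ×
    (∀ x y → x ∈ K → y ∈ K → f x ≡ f y → x ≡ y) ×
    (∀ x y → x ∈ K → y ∈ K → arc T x y ≡ arc T' (f x) (f y))

Hypomorphic : ∀ {v} → ℕ → Tournament v → Tournament v → Set
Hypomorphic {v} h T T' = ∀ (K : Subset v) → ∣ K ∣ ≡ h → InducedIso T T' K

HypomorphicLe : ∀ {v} → ℕ → Tournament v → Tournament v → Set
HypomorphicLe k T T' = ∀ h → h ≤ k → Hypomorphic h T T'

inS : ∀ {v} → Subset v → Fin v → Bool
inS K x = ⌊ Data.Fin.Subset.Properties._∈?_ x K ⌋
  where import Data.Fin.Subset.Properties

cyclic : ∀ {v} → Tournament v → Fin v → Fin v → Fin v → Bool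
cyclic T x y z = (arc T x y ∧ arc T y z ∧ arc T z x)
               ∨ (arc T x z ∧ arc T z y ∧ arc T y x)

triples : (v : ℕ) → List (Fin v × Fin v × Fin v)
triples v =
  concatMap (λ x → concatMap (λ y → concatMap (λ z →
    if ⌊ x <? y ⌋ ∧ ⌊ y <? z ⌋ then (x Data.Product., y Data.Product., z) ∷ [] else [])
    (allFin v)) (allFin v)) (allFin v)

c3 : ∀ {v} → Tournament v → Subset v → ℕ
c3 {v} T K = length (filter (λ t → Data.Bool._≟_ (ok t) true) (triples v))
  where
  ok : Fin v × Fin v × Fin v → Bool
  ok (x Data.Product., y Data.Product., z) =
    inS K x ∧ inS K y ∧ inS K z ∧ cyclic T x y z

_≡_[mod_] : ℕ → ℕ → ℕ → Set
a ≡ b [mod m ] = (+ m) ∣ℤ ((+ a) - (+ b))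

module Submission where

-- Write w(x, y, z) = [xyz cyclic in T] - [xyz cyclic in T′] and S(K) = Σ_{t ⊆ K, |t| = 3} w(t),
-- so that S(K) = c3(T|K) - c3(T′|K) vanishes modulo m on all k-sets K. As a set function S has
-- degree three: its third finite difference Δ_x Δ_c Δ_a S (K) equals w(x, c, a) for every K
-- avoiding x, c, a, while lower differences at ∅ vanish. Taking alternating sums of S over
-- k-sets and growing the sets one point at a time, first (k - 2)·h ≡ 0 for the cross difference
-- h = w(xca) - w(xcb) - w(xda) + w(xdb), then C(k-1, 2)·(w(xca) - w(xcb)) ≡ 0, so w changes by
-- a multiple of m when one vertex of a triangle is replaced, provided m ∤ k - 2 and m ∤ C(k-1, 2).
-- If m = 0 or m ≥ 3 the values w ∈ {-1, 0, 1} are then equal, and a triangle where T and T′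
-- disagree would put one vertex into three cyclic triangles of a 4-set, which is impossible.
-- If m = 2, w is constant modulo 2 on all triangles, hence S(K) ≡ C(k, 3)·w, and C(k, 3) odd
-- forces w ≡ 0. Finally, agreeing on the cyclic triangles means (≤ 3)-hypomorphic, because a
-- tournament on three vertices is determined up to isomorphism by whether it is cyclic.

open import Defs
open import Data.Nat as ℕ using (ℕ; zero; suc; _≤_; z≤n; s≤s)
import Data.Nat.Properties as ℕ
open import Data.Nat.Divisibility as ℕ∣ using (_∣_; divides)
open import Data.Nat.Primality using (Prime; euclidsLemma; prime[2])
open import Data.Nat.Combinatorics using (_C_; nC1≡n; nCk+nC[k+1]≡[n+1]C[k+1])
import Data.Nat.Tactic.RingSolver as ℕSolver
open import Data.Bool using (Bool; true; false; not; _∧_; _∨_; if_then_else_)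
import Data.Bool.Properties as Bool
open import Data.Fin using (Fin; zero; suc; _≟_; _<_)
open import Data.Fin.Patterns using (0F; 1F; 2F)
open import Data.Fin.Properties as Fin using (_<?_; <-irrefl; <-asym; <-trans; <⇒≢; <-cmp; any?; all?; ¬∀⟶∃¬)
open import Data.Fin.Subset using (Subset; _∈_; _∉_; ∣_∣; inside; outside) renaming (⊥ to ∅; _-_ to _∖_)
open import Data.Fin.Subset.Properties
  using (_∈?_; ∉⊥; x∈p∧x≢y⇒x∈p-y; x∈p⇒∣p-x∣<∣p∣; ∣p∣≤∣x∷p∣; p─q⊆p; ∣⊥∣≡0; ∣⊤∣≡n; ⊆⊤; ⊆-antisym;
         nonempty?; Empty-unique; p─⊥≡p)
open import Data.Fin.Permutation using (Permutation′; _⟨$⟩ʳ_; _⟨$⟩ˡ_; inverseˡ; inverseʳ; transpose; _∘ₚ_)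
  renaming (id to idₚ)
open import Data.Vec using (_∷_; _[_]≔_) renaming (here to hereᵥ; there to thereᵥ)
open import Data.Vec.Properties
  using ([]≔-updates; []≔-minimal; []≔-commutes; []≔-idempotent; lookup∘update′; []=⇒lookup; lookup⇒[]=)
open import Data.Integer as ℤ using (ℤ; +_; 0ℤ; 1ℤ; _+_; _-_; _*_)
import Data.Integer.Properties as ℤ
open import Data.Integer.Divisibility.Signed as ℤ∣ using () renaming (_∣_ to _∣ℤ_)
open import Data.Integer.Tactic.RingSolver using (solve-∀)
open import Algebra.Properties.CommutativeMonoid.Sum ℤ.+-0-commutativeMonoid using (sum-syntax; sum-cong-≗)
open import Data.List using (List; []; _∷_; _++_; concatMap; filter; length; allFin; tabulate)
open import Data.List.Relation.Unary.All as All using (All; []; _∷_)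
open import Data.List.Relation.Unary.Any using (here; there)
open import Data.List.Membership.Propositional using () renaming (_∉_ to _∉ₗ_)
open import Data.Product using (Σ; ∃; _×_; _,_; proj₁; proj₂)
open import Data.Sum using (_⊎_; inj₁; inj₂)
open import Data.Empty using (⊥; ⊥-elim)
open import Function using (_∘_; id)
open import Relation.Binary.Bundles using (Setoid)
open import Relation.Binary.Structures using (IsEquivalence)
open import Relation.Binary.Definitions using (tri<; tri≈; tri>)
import Relation.Binary.Reasoning.Setoid
open import Relation.Binary.PropositionalEquality
open import Relation.Nullary using (¬_; yes; no; contradiction)
open import Relation.Nullary.Decidable using (⌊_⌋; True; toWitness)

private variable v : ℕ

-- Subsets

insert : Subset v → Fin v → Subset v
insert L x = L [ x ]≔ inside

edge : Fin v → Fin v → Subset v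
edge c a = insert (insert ∅ c) a

triangle : Fin v → Fin v → Fin v → Subset v
triangle x c a = insert (insert (insert ∅ x) c) a

Distinct : {A : Set} → A → A → A → Set
Distinct x y z = x ≢ y × x ≢ z × y ≢ z

module _ {L : Subset v} {x : Fin v} where

  x∈insert : x ∈ insert L x
  x∈insert = []≔-updates L x

  ∈-insert⁺ : ∀ {y} → y ∈ L → y ∈ insert L x
  ∈-insert⁺ {y} y∈L with y ≟ x
  ... | yes refl = x∈insert
  ... | no y≢x = []≔-minimal L y x y≢x y∈L

  ∈-insert⁻ : ∀ {y} → y ∈ insert L x → y ≢ x → y ∈ L
  ∈-insert⁻ {y} y∈ y≢x = lookup⇒[]= y L (trans (sym (lookup∘update′ y≢x L inside)) ([]=⇒lookup y∈))

  ∉-insert : ∀ {y} → y ∉ L → y ≢ x → y ∉ insert L x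
  ∉-insert y∉L y≢x y∈ = y∉L (∈-insert⁻ y∈ y≢x)

∣insert∣ : (L : Subset v) {x : Fin v} → x ∉ L → ∣ insert L x ∣ ≡ suc ∣ L ∣
∣insert∣ (outside ∷ L) {zero} x∉L = refl
∣insert∣ (inside ∷ L) {zero} x∉L = contradiction hereᵥ x∉L
∣insert∣ (outside ∷ L) {suc x} x∉L = ∣insert∣ L (x∉L ∘ thereᵥ)
∣insert∣ (inside ∷ L) {suc x} x∉L = cong suc (∣insert∣ L (x∉L ∘ thereᵥ))

∣insert∣≤ : (L : Subset v) (x : Fin v) → ∣ insert L x ∣ ≤ suc ∣ L ∣
∣insert∣≤ (b ∷ L) zero = s≤s (∣p∣≤∣x∷p∣ b L)
∣insert∣≤ (outside ∷ L) (suc x) = ∣insert∣≤ L x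
∣insert∣≤ (inside ∷ L) (suc x) = s≤s (∣insert∣≤ L x)

insert-comm : (L : Subset v) (x y : Fin v) → insert (insert L x) y ≡ insert (insert L y) x
insert-comm L x y with x ≟ y
... | yes refl = refl
... | no x≢y = []≔-commutes L x y x≢y

insert-remove : {L : Subset v} {x : Fin v} → x ∈ L → insert (L ∖ x) x ≡ L
insert-remove {L = .inside ∷ L} {zero} hereᵥ = cong (inside ∷_) (p─⊥≡p L)
insert-remove {L = b ∷ L} {suc x} (thereᵥ x∈L) = cong (b ∷_) (insert-remove x∈L)

x∉p∖x : (L : Subset v) (x : Fin v) → x ∉ L ∖ x
x∉p∖x (b ∷ L) zero ()
x∉p∖x (b ∷ L) (suc x) (thereᵥ x∈) = x∉p∖x L x x∈

∣p∣≡0⇒p≡∅ : (L : Subset v) → ∣ L ∣ ≡ 0 → L ≡ ∅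
∣p∣≡0⇒p≡∅ L ∣L∣≡0 =
  Empty-unique λ (x , x∈L) → ℕ.n≮0 (subst (λ k → ∣ L ∖ x ∣ ℕ.< k) ∣L∣≡0 (x∈p⇒∣p-x∣<∣p∣ x∈L))

remove-one : {v : ℕ} (L : Subset v) {h : ℕ} → ∣ L ∣ ≡ suc h → ∃ λ x → x ∈ L × ∣ L ∖ x ∣ ≡ h
remove-one {v} L {h} ∣L∣≡ with nonempty? L
... | yes (x , x∈L) = x , x∈L , ℕ.suc-injective (begin
      suc ∣ L ∖ x ∣          ≡⟨ ∣insert∣ (L ∖ x) (x∉p∖x L x) ⟨
      ∣ insert (L ∖ x) x ∣   ≡⟨ cong ∣_∣ (insert-remove x∈L) ⟩
      ∣ L ∣                  ≡⟨ ∣L∣≡ ⟩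
      suc h                  ∎)
  where open ≡-Reasoning
... | no L-empty =
  contradiction (trans (sym ∣L∣≡) (trans (cong ∣_∣ (Empty-unique L-empty)) (∣⊥∣≡0 v))) λ ()

Avoids : List (Fin v) → Subset v → Set
Avoids F L = All (_∉ L) F

avoids-insert : {F : List (Fin v)} {L : Subset v} {x : Fin v} → Avoids F L → x ∉ₗ F → Avoids F (insert L x)
avoids-insert [] x∉F = []
avoids-insert (f∉L ∷ F∉L) x∉F = ∉-insert f∉L (λ f≡x → x∉F (here (sym f≡x))) ∷ avoids-insert F∉L (x∉F ∘ there)

fresh : (F : List (Fin v)) (L : Subset v) → ∣ L ∣ ℕ.+ length F ℕ.< v → ∃ λ x → x ∉ L × x ∉ₗ F
fresh {v} [] L room with ¬∀⟶∃¬ v (_∈ L) (_∈? L) not-full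
  where
  not-full : ¬ (∀ x → x ∈ L)
  not-full full = ℕ.<-irrefl refl (subst (λ k → k ℕ.< v) (trans (ℕ.+-identityʳ ∣ L ∣) ∣L∣≡v) room)
    where
    ∣L∣≡v : ∣ L ∣ ≡ v
    ∣L∣≡v = trans (cong ∣_∣ (⊆-antisym ⊆⊤ (λ {x} _ → full x))) (∣⊤∣≡n v)
... | x , x∉L = x , x∉L , λ ()
fresh {v} (a ∷ F) L room with fresh F (insert L a) room′
  where
  open ℕ.≤-Reasoning
  room′ : ∣ insert L a ∣ ℕ.+ length F ℕ.< v
  room′ = begin-strict
    ∣ insert L a ∣ ℕ.+ length F   ≤⟨ ℕ.+-monoˡ-≤ (length F) (∣insert∣≤ L a) ⟩
    suc ∣ L ∣ ℕ.+ length F        ≡⟨ ℕ.+-suc ∣ L ∣ (length F) ⟨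
    ∣ L ∣ ℕ.+ length (a ∷ F)      <⟨ room ⟩
    v                             ∎
... | x , x∉L+a , x∉F =
  x , x∉L+a ∘ ∈-insert⁺ , λ { (here refl) → x∉L+a x∈insert ; (there x∈F) → x∉F x∈F }

choose-subset : (F : List (Fin v)) (n : ℕ) → n ℕ.+ length F ≤ v → ∃ λ L → ∣ L ∣ ≡ n × Avoids F L
choose-subset {v} F zero _ = ∅ , ∣⊥∣≡0 v , All.tabulate (λ _ → ∉⊥)
choose-subset F (suc n) room with choose-subset F n (ℕ.≤-trans (ℕ.n≤1+n _) room)
... | L , ∣L∣≡n , L∩F with fresh F L (subst (λ k → k ℕ.+ length F ℕ.< _) (sym ∣L∣≡n) room)
... | x , x∉L , x∉F = insert L x , trans (∣insert∣ L x∉L) (cong suc ∣L∣≡n) , avoids-insert L∩F x∉F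

insert-induction : (F : List (Fin v)) (P : Subset v → Set) → P ∅ →
  (∀ L x → Avoids F L → x ∉ L → x ∉ₗ F → P L → P (insert L x)) →
  ∀ L → Avoids F L → P L
insert-induction F P base step L = go ∣ L ∣ L refl
  where
  go : ∀ n L → ∣ L ∣ ≡ n → Avoids F L → P L
  go zero L ∣L∣≡0 _ = subst P (sym (∣p∣≡0⇒p≡∅ L ∣L∣≡0)) base
  go (suc n) L ∣L∣≡ L∩F with remove-one L ∣L∣≡
  ... | x , x∈L , ∣L∖x∣≡n =
    subst P (insert-remove x∈L) (step (L ∖ x) x L∖x∩F (x∉p∖x L x) x∉F (go n (L ∖ x) ∣L∖x∣≡n L∖x∩F))
    where
    L∖x∩F : Avoids F (L ∖ x)
    L∖x∩F = All.map (λ f∉L f∈ → f∉L (p─q⊆p L _ f∈)) L∩F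
    x∉F : x ∉ₗ F
    x∉F x∈F = All.lookup L∩F x∈F x∈L

-- Sums over ascending triples

𝟙 : Bool → ℤ
𝟙 true = 1ℤ
𝟙 false = 0ℤ

𝟙-∧ : ∀ p q → 𝟙 (p ∧ q) ≡ 𝟙 p * 𝟙 q
𝟙-∧ true q = sym (ℤ.*-identityˡ (𝟙 q))
𝟙-∧ false q = refl

∑-zero : ∀ {n} {f : Fin n → ℤ} → (∀ i → f i ≡ 0ℤ) → ∑[ i < n ] f i ≡ 0ℤ
∑-zero {zero} f≡0 = refl
∑-zero {suc n} f≡0 = cong₂ _+_ (f≡0 zero) (∑-zero (f≡0 ∘ suc))

∑-single : ∀ {n} {f : Fin n → ℤ} (i₀ : Fin n) → (∀ i → i ≢ i₀ → f i ≡ 0ℤ) → ∑[ i < n ] f i ≡ f i₀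
∑-single {f = f} zero f≡0 = trans (cong (_+_ (f zero)) (∑-zero (λ i → f≡0 (suc i) λ ()))) (ℤ.+-identityʳ _)
∑-single (suc i₀) f≡0 =
  trans (cong₂ _+_ (f≡0 zero λ ()) (∑-single i₀ (λ i i≢i₀ → f≡0 (suc i) (i≢i₀ ∘ Fin.suc-injective))))
        (ℤ.+-identityˡ _)

∑-distrib-- : ∀ {n} (f g : Fin n → ℤ) → ∑[ i < n ] (f i - g i) ≡ ∑[ i < n ] f i - ∑[ i < n ] g i
∑-distrib-- {zero} f g = refl
∑-distrib-- {suc n} f g =
  trans (cong (_+_ (f zero - g zero)) (∑-distrib-- (f ∘ suc) (g ∘ suc)))
        (interchange (f zero) (g zero) (∑[ i < n ] f (suc i)) (∑[ i < n ] g (suc i)))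
  where
  interchange : ∀ a b c d → (a - b) + (c - d) ≡ (a + c) - (b + d)
  interchange = solve-∀

ascending : Fin v → Fin v → Fin v → Bool
ascending x y z = ⌊ x <? y ⌋ ∧ ⌊ y <? z ⌋

Σ₃ : (Fin v → Fin v → Fin v → ℤ) → ℤ
Σ₃ {v} f = ∑[ x < v ] ∑[ y < v ] ∑[ z < v ] (𝟙 (ascending x y z) * f x y z)

Σ₃-cong : (f g : Fin v → Fin v → Fin v → ℤ) → (∀ x y z → x < y → y < z → f x y z ≡ g x y z) → Σ₃ f ≡ Σ₃ g
Σ₃-cong f g f≡g = sum-cong-≗ λ x → sum-cong-≗ λ y → sum-cong-≗ λ z → guarded x y z
  where
  guarded : ∀ x y z → 𝟙 (ascending x y z) * f x y z ≡ 𝟙 (ascending x y z) * g x y z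
  guarded x y z with x <? y | y <? z
  ... | yes x<y | yes y<z = cong (1ℤ *_) (f≡g x y z x<y y<z)
  ... | yes _   | no _    = refl
  ... | no _    | _       = refl

Σ₃-zero : (f : Fin v → Fin v → Fin v → ℤ) → (∀ x y z → x < y → y < z → f x y z ≡ 0ℤ) → Σ₃ f ≡ 0ℤ
Σ₃-zero {v} f f≡0 = trans (Σ₃-cong f (λ _ _ _ → 0ℤ) f≡0)
  (∑-zero {v} λ x → ∑-zero {v} λ y → ∑-zero {v} λ z → ℤ.*-zeroʳ (𝟙 (ascending x y z)))

Σ₃-distrib-- : (f g : Fin v → Fin v → Fin v → ℤ) → Σ₃ (λ x y z → f x y z - g x y z) ≡ Σ₃ f - Σ₃ g
Σ₃-distrib-- {v} f g =
  trans (sum-cong-≗ λ x → trans (sum-cong-≗ λ y →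
           trans (sum-cong-≗ λ z → *-distribˡ-- (𝟙 (ascending x y z)) (f x y z) (g x y z))
                 (∑-distrib-- (F x y) (G x y)))
         (∑-distrib-- (λ y → ∑[ z < v ] F x y z) (λ y → ∑[ z < v ] G x y z)))
  (∑-distrib-- (λ x → ∑[ y < v ] ∑[ z < v ] F x y z) (λ x → ∑[ y < v ] ∑[ z < v ] G x y z))
  where
  F G : Fin v → Fin v → Fin v → ℤ
  F x y z = 𝟙 (ascending x y z) * f x y z
  G x y z = 𝟙 (ascending x y z) * g x y z
  *-distribˡ-- : ∀ a b c → a * (b - c) ≡ a * b - a * c
  *-distribˡ-- = solve-∀

Σ₃-single : (f : Fin v → Fin v → Fin v → ℤ) {α β γ : Fin v} → α < β → β < γ →
  (∀ x y z → x < y → y < z → ¬ (x ≡ α × y ≡ β × z ≡ γ) → f x y z ≡ 0ℤ) → Σ₃ f ≡ f α β γ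
Σ₃-single f {α} {β} {γ} α<β β<γ elsewhere =
  trans (∑-single α λ x x≢α → ∑-zero λ y → ∑-zero λ z → off-target x y z λ (x≡α , _) → x≢α x≡α)
  (trans (∑-single β λ y y≢β → ∑-zero λ z → off-target α y z λ (_ , y≡β , _) → y≢β y≡β)
  (trans (∑-single γ λ z z≢γ → off-target α β z λ (_ , _ , z≡γ) → z≢γ z≡γ)
  (trans (cong (_* f α β γ) ascending-αβγ) (ℤ.*-identityˡ _))))
  where
  ascending-αβγ : 𝟙 (ascending α β γ) ≡ 1ℤ
  ascending-αβγ with α <? β | β <? γ
  ... | yes _ | yes _   = refl
  ... | yes _ | no β≮γ  = contradiction β<γ β≮γ
  ... | no α≮β | _      = contradiction α<β α≮β
  off-target : ∀ x y z → ¬ (x ≡ α × y ≡ β × z ≡ γ) → 𝟙 (ascending x y z) * f x y z ≡ 0ℤ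
  off-target x y z ne with x <? y | y <? z
  ... | yes x<y | yes y<z = cong (1ℤ *_) (elsewhere x y z x<y y<z ne)
  ... | yes _   | no _    = refl
  ... | no _    | _       = refl

ΣL : {A : Set} → List A → (A → ℤ) → ℤ
ΣL [] f = 0ℤ
ΣL (a ∷ l) f = f a + ΣL l f

ΣL-++ : {A : Set} (l₁ l₂ : List A) (f : A → ℤ) → ΣL (l₁ ++ l₂) f ≡ ΣL l₁ f + ΣL l₂ f
ΣL-++ [] l₂ f = sym (ℤ.+-identityˡ _)
ΣL-++ (a ∷ l₁) l₂ f = trans (cong (_+_ (f a)) (ΣL-++ l₁ l₂ f)) (sym (ℤ.+-assoc (f a) _ _))

ΣL-concatMap : {A B : Set} (g : A → List B) (l : List A) (f : B → ℤ) →
  ΣL (concatMap g l) f ≡ ΣL l (λ a → ΣL (g a) f)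
ΣL-concatMap g [] f = refl
ΣL-concatMap g (a ∷ l) f = trans (ΣL-++ (g a) (concatMap g l) f) (cong (_+_ (ΣL (g a) f)) (ΣL-concatMap g l f))

ΣL-tabulate : {A : Set} {n : ℕ} (g : Fin n → A) (f : A → ℤ) → ΣL (tabulate g) f ≡ ∑[ i < n ] f (g i)
ΣL-tabulate {n = zero} g f = refl
ΣL-tabulate {n = suc n} g f = cong (_+_ (f (g zero))) (ΣL-tabulate (g ∘ suc) f)

length-filter : {A : Set} (ok : A → Bool) (l : List A) →
  + length (filter (λ a → ok a Data.Bool.≟ true) l) ≡ ΣL l (𝟙 ∘ ok)
length-filter ok [] = refl
length-filter ok (a ∷ l) with ok a
... | true = trans (sym (ℤ.pos-+ 1 _)) (cong (_+_ 1ℤ) (length-filter ok l))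
... | false = trans (length-filter ok l) (sym (ℤ.+-identityˡ _))

ΣL-triples : (f : Fin v × Fin v × Fin v → ℤ) → ΣL (triples v) f ≡ Σ₃ (λ x y z → f (x , y , z))
ΣL-triples {v} f =
  trans (ΣL-concatMap row₁ (allFin v) f) (trans (ΣL-tabulate id (λ x → ΣL (row₁ x) f)) (sum-cong-≗ λ x →
  trans (ΣL-concatMap (row₂ x) (allFin v) f) (trans (ΣL-tabulate id (λ y → ΣL (row₂ x y) f)) (sum-cong-≗ λ y →
  trans (ΣL-concatMap (row₃ x y) (allFin v) f) (trans (ΣL-tabulate id (λ z → ΣL (row₃ x y z) f)) (sum-cong-≗ λ z →
  singleton-if (ascending x y z) (x , y , z)))))))
  where
  row₃ : Fin v → Fin v → Fin v → List (Fin v × Fin v × Fin v)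
  row₃ x y z = if ascending x y z then (x , y , z) ∷ [] else []
  row₂ : Fin v → Fin v → List (Fin v × Fin v × Fin v)
  row₂ x y = concatMap (row₃ x y) (allFin v)
  row₁ : Fin v → List (Fin v × Fin v × Fin v)
  row₁ x = concatMap (row₂ x) (allFin v)
  singleton-if : ∀ b t → ΣL (if b then t ∷ [] else []) f ≡ 𝟙 b * f t
  singleton-if true t = trans (ℤ.+-identityʳ _) (sym (ℤ.*-identityˡ _))
  singleton-if false t = refl

-- Indicators and finite differences

χ : Subset v → Fin v → ℤ
χ L z = 𝟙 (inS L z)

χ-∈ : {L : Subset v} {z : Fin v} → z ∈ L → χ L z ≡ 1ℤ
χ-∈ {L = L} {z} z∈L with z ∈? L
... | yes _ = refl
... | no z∉L = contradiction z∈L z∉L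

χ-∉ : {L : Subset v} {z : Fin v} → z ∉ L → χ L z ≡ 0ℤ
χ-∉ {L = L} {z} z∉L with z ∈? L
... | yes z∈L = contradiction z∈L z∉L
... | no _ = refl

δ : Fin v → Fin v → ℤ
δ x z = 𝟙 ⌊ z ≟ x ⌋

χ-insert : {L : Subset v} {x : Fin v} → x ∉ L → ∀ z → χ (insert L x) z ≡ χ L z + δ x z
χ-insert {L = L} {x} x∉L z with z ≟ x
... | yes refl = trans (χ-∈ x∈insert) (cong (_+ 1ℤ) (sym (χ-∉ x∉L)))
... | no z≢x with z ∈? L
...   | yes z∈L = trans (χ-∈ (∈-insert⁺ z∈L)) (sym (ℤ.+-identityʳ 1ℤ))
...   | no z∉L = χ-∉ (∉-insert z∉L z≢x)

χ-insert₂ : {L : Subset v} {c a : Fin v} → c ∉ L → a ∉ L → c ≢ a →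
  ∀ z → χ (insert (insert L c) a) z ≡ (χ L z + δ c z) + δ a z
χ-insert₂ c∉L a∉L c≢a z = trans (χ-insert (∉-insert a∉L (c≢a ∘ sym)) z) (cong (_+ δ _ z) (χ-insert c∉L z))

χ-insert₃ : {L : Subset v} {x c a : Fin v} → x ∉ L → c ∉ L → a ∉ L → Distinct x c a →
  ∀ z → χ (insert (insert (insert L x) c) a) z ≡ ((χ L z + δ x z) + δ c z) + δ a z
χ-insert₃ x∉L c∉L a∉L (x≢c , x≢a , c≢a) z =
  trans (χ-insert (∉-insert (∉-insert a∉L (x≢a ∘ sym)) (c≢a ∘ sym)) z)
        (cong (_+ δ _ z) (χ-insert₂ x∉L c∉L x≢c z))

χ-∅ : (z : Fin v) → χ ∅ z ≡ 0ℤ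
χ-∅ z = χ-∉ ∉⊥

δ-disjoint : {y z : Fin v} (x : Fin v) → y ≢ z → δ x y * δ x z ≡ 0ℤ
δ-disjoint {y = y} {z} x y≢z with y ≟ x | z ≟ x
... | yes refl | yes refl = contradiction refl y≢z
... | yes _ | no _ = refl
... | no _ | _ = refl

Δ : Fin v → (Subset v → ℤ) → Subset v → ℤ
Δ x F L = F (insert L x) - F L

Δ-cong : {F G : Subset v → ℤ} (x : Fin v) → (∀ L → F L ≡ G L) → ∀ K → Δ x F K ≡ Δ x G K
Δ-cong x F≗G K = cong₂ _-_ (F≗G (insert K x)) (F≗G K)

Δ-sub : (F G : Subset v → ℤ) (x : Fin v) (L : Subset v) → Δ x (λ K → F K - G K) L ≡ Δ x F L - Δ x G L
Δ-sub F G x L = interchange (F (insert L x)) (G (insert L x)) (F L) (G L)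
  where
  interchange : ∀ a b c d → (a - b) - (c - d) ≡ (a - c) - (b - d)
  interchange = solve-∀

cube : (Fin v → ℤ) → Fin v → Fin v → Fin v → ℤ
cube φ y₁ y₂ y₃ = φ y₁ * φ y₂ * φ y₃

χ³ : Subset v → Fin v → Fin v → Fin v → ℤ
χ³ L = cube (χ L)

cube-cong : {φ ψ : Fin v → ℤ} → (∀ z → φ z ≡ ψ z) → ∀ y₁ y₂ y₃ → cube φ y₁ y₂ y₃ ≡ cube ψ y₁ y₂ y₃
cube-cong φ≗ψ y₁ y₂ y₃ = cong₂ _*_ (cong₂ _*_ (φ≗ψ y₁) (φ≗ψ y₂)) (φ≗ψ y₃)

-- The monomials of ∏ᵢ (xᵢ + cᵢ + aᵢ) in which one of the letters x, c, a occurs at two positions.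
collisions : (x₁ x₂ x₃ c₁ c₂ c₃ a₁ a₂ a₃ : ℤ) → ℤ
collisions x₁ x₂ x₃ c₁ c₂ c₃ a₁ a₂ a₃ =
    x₁ * x₂ * (x₃ + c₃ + a₃) + x₁ * x₃ * (c₂ + a₂) + x₂ * x₃ * (c₁ + a₁)
  + c₁ * c₂ * (x₃ + c₃ + a₃) + c₁ * c₃ * (x₂ + a₂) + c₂ * c₃ * (x₁ + a₁)
  + a₁ * a₂ * (x₃ + c₃ + a₃) + a₁ * a₃ * (x₂ + c₂) + a₂ * a₃ * (x₁ + c₁)

-- Inclusion-exclusion over the three inserted points leaves the monomials using each of x, c, a
-- exactly once, i.e. the full product minus the collisions (spelled out here for the solver).
third-difference : ∀ (k₁ k₂ k₃ x₁ x₂ x₃ c₁ c₂ c₃ a₁ a₂ a₃ : ℤ) →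
  ((((k₁ + x₁) + c₁) + a₁) * (((k₂ + x₂) + c₂) + a₂) * (((k₃ + x₃) + c₃) + a₃)
     - ((k₁ + x₁) + c₁) * ((k₂ + x₂) + c₂) * ((k₃ + x₃) + c₃)
   - (((k₁ + x₁) + a₁) * ((k₂ + x₂) + a₂) * ((k₃ + x₃) + a₃) - (k₁ + x₁) * (k₂ + x₂) * (k₃ + x₃)))
  - ((((k₁ + c₁) + a₁) * ((k₂ + c₂) + a₂) * ((k₃ + c₃) + a₃) - (k₁ + c₁) * (k₂ + c₂) * (k₃ + c₃))
   - ((k₁ + a₁) * (k₂ + a₂) * (k₃ + a₃) - k₁ * k₂ * k₃))
  ≡ (((0ℤ + x₁) + c₁) + a₁) * (((0ℤ + x₂) + c₂) + a₂) * (((0ℤ + x₃) + c₃) + a₃)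
    - ( x₁ * x₂ * (x₃ + c₃ + a₃) + x₁ * x₃ * (c₂ + a₂) + x₂ * x₃ * (c₁ + a₁)
      + c₁ * c₂ * (x₃ + c₃ + a₃) + c₁ * c₃ * (x₂ + a₂) + c₂ * c₃ * (x₁ + a₁)
      + a₁ * a₂ * (x₃ + c₃ + a₃) + a₁ * a₃ * (x₂ + c₂) + a₂ * a₃ * (x₁ + c₁))
third-difference = solve-∀

collisions-vanish : ∀ x₁ x₂ x₃ c₁ c₂ c₃ a₁ a₂ a₃ →
  x₁ * x₂ ≡ 0ℤ → x₁ * x₃ ≡ 0ℤ → x₂ * x₃ ≡ 0ℤ → c₁ * c₂ ≡ 0ℤ → c₁ * c₃ ≡ 0ℤ → c₂ * c₃ ≡ 0ℤ →
  a₁ * a₂ ≡ 0ℤ → a₁ * a₃ ≡ 0ℤ → a₂ * a₃ ≡ 0ℤ → collisions x₁ x₂ x₃ c₁ c₂ c₃ a₁ a₂ a₃ ≡ 0ℤ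
collisions-vanish _ _ _ _ _ _ _ _ _ x₁₂ x₁₃ x₂₃ c₁₂ c₁₃ c₂₃ a₁₂ a₁₃ a₂₃
  rewrite x₁₂ | x₁₃ | x₂₃ | c₁₂ | c₁₃ | c₂₃ | a₁₂ | a₁₃ | a₂₃ = refl

Δ³-χ³ : {K : Subset v} {x c a : Fin v} → x ∉ K → c ∉ K → a ∉ K → Distinct x c a →
  {y₁ y₂ y₃ : Fin v} → Distinct y₁ y₂ y₃ →
  Δ x (Δ c (Δ a (λ L → χ³ L y₁ y₂ y₃))) K ≡ χ³ (triangle x c a) y₁ y₂ y₃
Δ³-χ³ {v} {K} {x} {c} {a} x∉K c∉K a∉K xca@(x≢c , x≢a , c≢a) {y₁} {y₂} {y₃}
      (y₁≢y₂ , y₁≢y₃ , y₂≢y₃) =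
  trans (cong₂ _-_
          (cong₂ _-_ (cong₂ _-_ (expand (χ-insert₃ x∉K c∉K a∉K xca)) (expand (χ-insert₂ x∉K c∉K x≢c)))
                     (cong₂ _-_ (expand (χ-insert₂ x∉K a∉K x≢a)) (expand (χ-insert x∉K))))
          (cong₂ _-_ (cong₂ _-_ (expand (χ-insert₂ c∉K a∉K c≢a)) (expand (χ-insert c∉K)))
                     (cong₂ _-_ (expand (χ-insert a∉K)) refl)))
  (trans (third-difference (χ K y₁) (χ K y₂) (χ K y₃) (δ x y₁) (δ x y₂) (δ x y₃)
                           (δ c y₁) (δ c y₂) (δ c y₃) (δ a y₁) (δ a y₂) (δ a y₃))
  (trans (cong (target -_) (collisions-vanish (δ x y₁) (δ x y₂) (δ x y₃) (δ c y₁) (δ c y₂) (δ c y₃)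
                                              (δ a y₁) (δ a y₂) (δ a y₃)
            (δ-disjoint x y₁≢y₂) (δ-disjoint x y₁≢y₃) (δ-disjoint x y₂≢y₃)
            (δ-disjoint c y₁≢y₂) (δ-disjoint c y₁≢y₃) (δ-disjoint c y₂≢y₃)
            (δ-disjoint a y₁≢y₂) (δ-disjoint a y₁≢y₃) (δ-disjoint a y₂≢y₃)))
  (trans (ℤ.+-identityʳ target)
         (sym (expand λ z → trans (χ-insert₃ ∉⊥ ∉⊥ ∉⊥ xca z)
                                  (cong (λ k → ((k + δ x z) + δ c z) + δ a z) (χ-∅ z)))))))
  where
  target : ℤ
  target = cube (λ z → ((0ℤ + δ x z) + δ c z) + δ a z) y₁ y₂ y₃
  expand : {L : Subset v} {φ : Fin v → ℤ} → (∀ z → χ L z ≡ φ z) → χ³ L y₁ y₂ y₃ ≡ cube φ y₁ y₂ y₃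
  expand χ≗φ = cube-cong χ≗φ y₁ y₂ y₃

χ³-vanishes : {L : Subset v} {y₁ y₂ y₃ : Fin v} → ¬ (y₁ ∈ L × y₂ ∈ L × y₃ ∈ L) → χ³ L y₁ y₂ y₃ ≡ 0ℤ
χ³-vanishes {L = L} {y₁} {y₂} {y₃} ¬all with y₁ ∈? L | y₂ ∈? L | y₃ ∈? L
... | yes p | yes q | yes r = contradiction (p , q , r) ¬all
... | no _  | _     | _     = refl
... | yes _ | no _  | _     = refl
... | yes _ | yes _ | no _  = refl

∈-edge : {c a y : Fin v} → y ∈ edge c a → y ≡ a ⊎ y ≡ c
∈-edge {c = c} {a} {y} y∈ with y ≟ a | y ≟ c
... | yes y≡a | _ = inj₁ y≡a
... | no _ | yes y≡c = inj₂ y≡c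
... | no y≢a | no y≢c = contradiction (∈-insert⁻ (∈-insert⁻ y∈ y≢a) y≢c) ∉⊥

χ³-edge : {c a y₁ y₂ y₃ : Fin v} → Distinct y₁ y₂ y₃ → χ³ (edge c a) y₁ y₂ y₃ ≡ 0ℤ
χ³-edge {c = c} {a} {y₁} {y₂} {y₃} (y₁≢y₂ , y₁≢y₃ , y₂≢y₃) =
  χ³-vanishes λ (p , q , r) → pigeonhole (∈-edge p) (∈-edge q) (∈-edge r)
  where
  pigeonhole : y₁ ≡ a ⊎ y₁ ≡ c → y₂ ≡ a ⊎ y₂ ≡ c → y₃ ≡ a ⊎ y₃ ≡ c → ⊥
  pigeonhole (inj₁ refl) (inj₁ refl) _           = y₁≢y₂ refl
  pigeonhole (inj₂ refl) (inj₂ refl) _           = y₁≢y₂ refl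
  pigeonhole (inj₁ refl) (inj₂ refl) (inj₁ refl) = y₁≢y₃ refl
  pigeonhole (inj₁ refl) (inj₂ refl) (inj₂ refl) = y₂≢y₃ refl
  pigeonhole (inj₂ refl) (inj₁ refl) (inj₁ refl) = y₂≢y₃ refl
  pigeonhole (inj₂ refl) (inj₁ refl) (inj₂ refl) = y₁≢y₃ refl

∈-triangle : {α β γ y : Fin v} → y ∈ triangle α β γ → y ≡ α ⊎ y ≡ β ⊎ y ≡ γ
∈-triangle {α = α} {β} {γ} {y} y∈ with y ≟ γ | y ≟ β | y ≟ α
... | yes y≡γ | _ | _ = inj₂ (inj₂ y≡γ)
... | no _ | yes y≡β | _ = inj₂ (inj₁ y≡β)
... | no _ | no _ | yes y≡α = inj₁ y≡α
... | no y≢γ | no y≢β | no y≢α =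
  contradiction (∈-insert⁻ (∈-insert⁻ (∈-insert⁻ y∈ y≢γ) y≢β) y≢α) ∉⊥

ascending-unique : {α β γ x y z : Fin v} → α < β → β < γ → x < y → y < z →
  x ≡ α ⊎ x ≡ β ⊎ x ≡ γ → y ≡ α ⊎ y ≡ β ⊎ y ≡ γ → z ≡ α ⊎ z ≡ β ⊎ z ≡ γ →
  x ≡ α × y ≡ β × z ≡ γ
ascending-unique _ _ _ _ (inj₁ refl) (inj₂ (inj₁ refl)) (inj₂ (inj₂ refl)) = refl , refl , refl
ascending-unique _ _ x<y _ (inj₁ refl) (inj₁ refl) _ = ⊥-elim (<-irrefl refl x<y)
ascending-unique _ _ x<y _ (inj₂ (inj₁ refl)) (inj₂ (inj₁ refl)) _ = ⊥-elim (<-irrefl refl x<y)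
ascending-unique _ _ x<y _ (inj₂ (inj₂ refl)) (inj₂ (inj₂ refl)) _ = ⊥-elim (<-irrefl refl x<y)
ascending-unique _ _ _ y<z _ (inj₁ refl) (inj₁ refl) = ⊥-elim (<-irrefl refl y<z)
ascending-unique _ _ _ y<z _ (inj₂ (inj₁ refl)) (inj₂ (inj₁ refl)) = ⊥-elim (<-irrefl refl y<z)
ascending-unique _ _ _ y<z _ (inj₂ (inj₂ refl)) (inj₂ (inj₂ refl)) = ⊥-elim (<-irrefl refl y<z)
ascending-unique α<β _ x<y _ (inj₂ (inj₁ refl)) (inj₁ refl) _ = ⊥-elim (<-asym α<β x<y)
ascending-unique α<β β<γ x<y _ (inj₂ (inj₂ refl)) (inj₁ refl) _ = ⊥-elim (<-asym (<-trans α<β β<γ) x<y)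
ascending-unique _ β<γ x<y _ (inj₂ (inj₂ refl)) (inj₂ (inj₁ refl)) _ = ⊥-elim (<-asym β<γ x<y)
ascending-unique α<β _ _ y<z _ (inj₂ (inj₁ refl)) (inj₁ refl) = ⊥-elim (<-asym α<β y<z)
ascending-unique α<β β<γ _ y<z _ (inj₂ (inj₂ refl)) (inj₁ refl) = ⊥-elim (<-asym (<-trans α<β β<γ) y<z)
ascending-unique _ β<γ _ y<z _ (inj₂ (inj₂ refl)) (inj₂ (inj₁ refl)) = ⊥-elim (<-asym β<γ y<z)

ascending-distinct : {x y z : Fin v} → x < y → y < z → Distinct x y z
ascending-distinct x<y y<z = <⇒≢ x<y , <⇒≢ (<-trans x<y y<z) , <⇒≢ y<z

module CubicSetFunction {v : ℕ} (w : Fin v → Fin v → Fin v → ℤ) where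

  S[_] : (Subset v → Fin v → Fin v → Fin v → ℤ) → Subset v → ℤ
  S[ φ ] L = Σ₃ λ x y z → φ L x y z * w x y z

  S : Subset v → ℤ
  S = S[ χ³ ]

  W : Fin v → Fin v → Fin v → ℤ
  W x y z = S (triangle x y z)

  Δ₃ : Fin v → (Subset v → Fin v → Fin v → Fin v → ℤ) → Subset v → Fin v → Fin v → Fin v → ℤ
  Δ₃ a φ L x y z = Δ a (λ L′ → φ L′ x y z) L

  Δ-S[] : (a : Fin v) (φ : Subset v → Fin v → Fin v → Fin v → ℤ) → ∀ K → Δ a S[ φ ] K ≡ S[ Δ₃ a φ ] K
  Δ-S[] a φ K =
    trans (sym (Σ₃-distrib-- (λ x y z → φ (insert K a) x y z * w x y z) (λ x y z → φ K x y z * w x y z)))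
          (Σ₃-cong _ _ λ x y z _ _ → *-distribʳ-- (φ (insert K a) x y z) (φ K x y z) (w x y z))
    where
    *-distribʳ-- : ∀ p q r → p * r - q * r ≡ (p - q) * r
    *-distribʳ-- = solve-∀

  Δ³S : {K : Subset v} {x c a : Fin v} → x ∉ K → c ∉ K → a ∉ K → Distinct x c a →
    Δ x (Δ c (Δ a S)) K ≡ W x c a
  Δ³S {K} {x} {c} {a} x∉K c∉K a∉K xca =
    trans (Δ-cong x (Δ-cong c (Δ-S[] a χ³)) K)
    (trans (Δ-cong x (Δ-S[] c (Δ₃ a χ³)) K)
    (trans (Δ-S[] x (Δ₃ c (Δ₃ a χ³)) K)
           (Σ₃-cong _ _ λ y₁ y₂ y₃ y₁<y₂ y₂<y₃ →
              cong (_* w y₁ y₂ y₃) (Δ³-χ³ x∉K c∉K a∉K xca (ascending-distinct y₁<y₂ y₂<y₃)))))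

  S-edge : (c a : Fin v) → S (edge c a) ≡ 0ℤ
  S-edge c a = Σ₃-zero _ λ y₁ y₂ y₃ y₁<y₂ y₂<y₃ →
    cong (_* w y₁ y₂ y₃) (χ³-edge (ascending-distinct y₁<y₂ y₂<y₃))

  S-∅ : S ∅ ≡ 0ℤ
  S-∅ = Σ₃-zero _ λ y₁ y₂ y₃ _ _ →
    cong (_* w y₁ y₂ y₃) (χ³-vanishes {y₁ = y₁} {y₂} {y₃} λ (y₁∈∅ , _) → ∉⊥ y₁∈∅)

  S-singleton : (a : Fin v) → S (insert ∅ a) ≡ 0ℤ
  S-singleton a = trans (cong S (sym ([]≔-idempotent ∅ a))) (S-edge a a)

  ΔS-∅ : (a : Fin v) → Δ a S ∅ ≡ 0ℤ
  ΔS-∅ a rewrite S-singleton a | S-∅ = refl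

  ΔΔS-∅ : (c a : Fin v) → Δ c (Δ a S) ∅ ≡ 0ℤ
  ΔΔS-∅ c a rewrite S-edge c a | S-singleton c | S-singleton a | S-∅ = refl

  W-swap₁₂ : ∀ x y z → W x y z ≡ W y x z
  W-swap₁₂ x y z = cong (λ L → S (insert L z)) (insert-comm ∅ x y)

  W-swap₂₃ : ∀ x y z → W x y z ≡ W x z y
  W-swap₂₃ x y z = cong S (insert-comm (insert ∅ x) y z)

  W-ascending : {α β γ : Fin v} → α < β → β < γ → W α β γ ≡ w α β γ
  W-ascending {α} {β} {γ} α<β β<γ =
    trans (Σ₃-single _ α<β β<γ λ x y z x<y y<z ne → cong (_* w x y z) (χ³-vanishes λ (x∈ , y∈ , z∈) →
            ne (ascending-unique α<β β<γ x<y y<z (∈-triangle x∈) (∈-triangle y∈) (∈-triangle z∈))))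
    (trans (cong (_* w α β γ) (cong₂ _*_ (cong₂ _*_ (χ-∈ α∈) (χ-∈ β∈)) (χ-∈ x∈insert))) (ℤ.*-identityˡ _))
    where
    α∈ : α ∈ triangle α β γ
    α∈ = ∈-insert⁺ (∈-insert⁺ x∈insert)
    β∈ : β ∈ triangle α β γ
    β∈ = ∈-insert⁺ x∈insert

  module _ (w-swap₁₂ : ∀ x y z → w x y z ≡ w y x z) (w-swap₂₃ : ∀ x y z → w x y z ≡ w x z y) where

    private
      swap₁₂ : ∀ {a b c} → W a b c ≡ w a b c → W b a c ≡ w b a c
      swap₁₂ {a} {b} {c} W≡w = trans (sym (W-swap₁₂ a b c)) (trans W≡w (w-swap₁₂ a b c))
      swap₂₃ : ∀ {a b c} → W a b c ≡ w a b c → W a c b ≡ w a c b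
      swap₂₃ {a} {b} {c} W≡w = trans (sym (W-swap₂₃ a b c)) (trans W≡w (w-swap₂₃ a b c))

    W≡w : ∀ {x y z} → Distinct x y z → W x y z ≡ w x y z
    W≡w {x} {y} {z} (x≢y , x≢z , y≢z) with <-cmp x y | <-cmp y z | <-cmp x z
    ... | tri≈ _ x≡y _ | _ | _ = contradiction x≡y x≢y
    ... | _ | tri≈ _ y≡z _ | _ = contradiction y≡z y≢z
    ... | _ | _ | tri≈ _ x≡z _ = contradiction x≡z x≢z
    ... | tri< x<y _ _ | tri< y<z _ _ | _ = W-ascending x<y y<z
    ... | tri< _ _ _ | tri> _ _ z<y | tri< x<z _ _ = swap₂₃ (W-ascending x<z z<y)
    ... | tri< x<y _ _ | tri> _ _ _ | tri> _ _ z<x = swap₂₃ (swap₁₂ (W-ascending z<x x<y))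
    ... | tri> _ _ y<x | tri< _ _ _ | tri< x<z _ _ = swap₁₂ (W-ascending y<x x<z)
    ... | tri> _ _ _ | tri< y<z _ _ | tri> _ _ z<x = swap₁₂ (swap₂₃ (W-ascending y<z z<x))
    ... | tri> _ _ y<x | tri> _ _ z<y | _ = swap₂₃ (swap₁₂ (swap₂₃ (W-ascending z<y y<x)))

-- Congruences

module Modulo (m : ℕ) where

  infix 4 _≈_
  record _≈_ (a b : ℤ) : Set where
    constructor mod
    field divides-difference : + m ∣ℤ a - b

  ≈-refl : ∀ {a} → a ≈ a
  ≈-refl {a} = mod (subst (+ m ∣ℤ_) (sym (ℤ.+-inverseʳ a)) (ℤ∣.divides 0ℤ refl))

  ≡⇒≈ : ∀ {a b} → a ≡ b → a ≈ b
  ≡⇒≈ refl = ≈-refl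

  ≈-sym : ∀ {a b} → a ≈ b → b ≈ a
  ≈-sym {a} {b} (mod m∣a-b) = mod (subst (+ m ∣ℤ_) (negate-difference a b) (ℤ∣.∣m⇒∣-m m∣a-b))
    where
    negate-difference : ∀ a b → ℤ.- (a - b) ≡ b - a
    negate-difference = solve-∀

  ≈-trans : ∀ {a b c} → a ≈ b → b ≈ c → a ≈ c
  ≈-trans {a} {b} {c} (mod m∣a-b) (mod m∣b-c) =
    mod (subst (+ m ∣ℤ_) (telescope a b c) (ℤ∣.∣m∣n⇒∣m+n m∣a-b m∣b-c))
    where
    telescope : ∀ a b c → (a - b) + (b - c) ≡ a - c
    telescope = solve-∀

  ≈-isEquivalence : IsEquivalence _≈_
  ≈-isEquivalence = record { refl = ≈-refl ; sym = ≈-sym ; trans = ≈-trans }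

  ≈-setoid : Setoid _ _
  ≈-setoid = record { isEquivalence = ≈-isEquivalence }

  module ≈-Reasoning = Relation.Binary.Reasoning.Setoid ≈-setoid

  +-cong : ∀ {a b c d} → a ≈ b → c ≈ d → a + c ≈ b + d
  +-cong {a} {b} {c} {d} (mod m∣a-b) (mod m∣c-d) =
    mod (subst (+ m ∣ℤ_) (interchange a b c d) (ℤ∣.∣m∣n⇒∣m+n m∣a-b m∣c-d))
    where
    interchange : ∀ a b c d → (a - b) + (c - d) ≡ (a + c) - (b + d)
    interchange = solve-∀

  sub-cong : ∀ {a b c d} → a ≈ b → c ≈ d → a - c ≈ b - d
  sub-cong {a} {b} {c} {d} (mod m∣a-b) (mod m∣c-d) =
    mod (subst (+ m ∣ℤ_) (interchange a b c d) (ℤ∣.∣m∣n⇒∣m-n m∣a-b m∣c-d))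
    where
    interchange : ∀ a b c d → (a - b) - (c - d) ≡ (a - c) - (b - d)
    interchange = solve-∀

  ≈0⇒∣ : ∀ {a} → a ≈ 0ℤ → + m ∣ℤ a
  ≈0⇒∣ {a} (mod m∣a-0) = subst (+ m ∣ℤ_) (ℤ.+-identityʳ a) m∣a-0

  ∣⇒≈0 : ∀ {a} → + m ∣ℤ a → a ≈ 0ℤ
  ∣⇒≈0 {a} m∣a = mod (subst (+ m ∣ℤ_) (sym (ℤ.+-identityʳ a)) m∣a)

  ≈-from-difference : ∀ {a b} → a - b ≈ 0ℤ → a ≈ b
  ≈-from-difference a-b≈0 = mod (≈0⇒∣ a-b≈0)

-- m is a prime or m = 0; the latter encodes exact equality.
PrimeModulus : ℕ → Set
PrimeModulus m = ∀ {a b} → m ∣ a ℕ.* b → (m ∣ a) ⊎ (m ∣ b)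

∤-* : ∀ {m a b} → PrimeModulus m → ¬ m ∣ a → ¬ m ∣ b → ¬ m ∣ a ℕ.* b
∤-* m-prime m∤a m∤b m∣ab with m-prime m∣ab
... | inj₁ m∣a = m∤a m∣a
... | inj₂ m∣b = m∤b m∣b

cancel : ∀ {m N x} → PrimeModulus m → ¬ m ∣ N → Modulo._≈_ m (+ N * x) 0ℤ → Modulo._≈_ m x 0ℤ
cancel {m} {N} {x} m-prime m∤N Nx≈0
  with m-prime (subst (m ∣_) (ℤ.abs-* (+ N) x) (ℤ∣.∣⇒∣ᵤ (Modulo.≈0⇒∣ m Nx≈0)))
... | inj₁ m∣N = contradiction m∣N m∤N
... | inj₂ m∣x = Modulo.∣⇒≈0 m (ℤ∣.∣ᵤ⇒∣ m∣x)

-- The vanishing argument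

-- Here k = 3 + n.
module Vanishing {v : ℕ} (w : Fin v → Fin v → Fin v → ℤ) {m : ℕ} (m-prime : PrimeModulus m)
  (n : ℕ) (room : 3 ℕ.+ n ℕ.+ 3 ≤ v)
  (vanish : ∀ K → ∣ K ∣ ≡ 3 ℕ.+ n → Modulo._≈_ m (CubicSetFunction.S w K) 0ℤ) where

  open CubicSetFunction w
  open Modulo m

  accumulate : (F : Subset v → ℤ) (excluded : List (Fin v)) (r : ℕ) (c : ℤ) → F ∅ ≡ 0ℤ →
    (∀ L x → Avoids excluded L → x ∉ L → x ∉ₗ excluded → Δ x F L ≈ + (∣ L ∣ C r) * c) →
    ∀ L → Avoids excluded L → F L ≈ + (∣ L ∣ C suc r) * c
  accumulate F excluded r c F∅≡0 ΔF≈ =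
    insert-induction excluded (λ L → F L ≈ + (∣ L ∣ C suc r) * c) base step
    where
    base : F ∅ ≈ + (∣ ∅ {v} ∣ C suc r) * c
    base = ≡⇒≈ (trans F∅≡0 (cong (λ k → + (k C suc r) * c) (sym (∣⊥∣≡0 v))))
    step : ∀ L x → Avoids excluded L → x ∉ L → x ∉ₗ excluded → F L ≈ + (∣ L ∣ C suc r) * c →
           F (insert L x) ≈ + (∣ insert L x ∣ C suc r) * c
    step L x L∩excluded x∉L x∉excluded FL≈ = begin
      F (insert L x)                               ≡⟨ split (F (insert L x)) (F L) ⟩
      Δ x F L + F L                                ≈⟨ +-cong (ΔF≈ L x L∩excluded x∉L x∉excluded) FL≈ ⟩
      + (∣ L ∣ C r) * c + + (∣ L ∣ C suc r) * c   ≡⟨ ℤ.*-distribʳ-+ c (+ (∣ L ∣ C r)) (+ (∣ L ∣ C suc r)) ⟨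
      (+ (∣ L ∣ C r) + + (∣ L ∣ C suc r)) * c      ≡⟨ cong (_* c) (ℤ.pos-+ (∣ L ∣ C r) (∣ L ∣ C suc r)) ⟨
      + (∣ L ∣ C r ℕ.+ ∣ L ∣ C suc r) * c          ≡⟨ cong (λ k → + k * c) (nCk+nC[k+1]≡[n+1]C[k+1] ∣ L ∣ r) ⟩
      + (suc ∣ L ∣ C suc r) * c                    ≡⟨ cong (λ k → + (k C suc r) * c) (∣insert∣ L x∉L) ⟨
      + (∣ insert L x ∣ C suc r) * c               ∎
      where
      open ≈-Reasoning
      split : ∀ a b → a ≡ (a - b) + b
      split = solve-∀

  pick-subset : (excluded : List (Fin v)) (i : ℕ) → i ℕ.+ length excluded ≤ 6 →
    ∃ λ L → ∣ L ∣ ≡ i ℕ.+ n × Avoids excluded L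
  pick-subset excluded i fits = choose-subset excluded (i ℕ.+ n)
    (ℕ.≤-trans (ℕ.≤-reflexive (shuffle i n (length excluded)))
    (ℕ.≤-trans (ℕ.+-monoʳ-≤ n fits) (ℕ.≤-trans (ℕ.≤-reflexive (six n)) room)))
    where
    shuffle : ∀ i n f → (i ℕ.+ n) ℕ.+ f ≡ n ℕ.+ (i ℕ.+ f)
    shuffle = ℕSolver.solve-∀
    six : ∀ n → n ℕ.+ 6 ≡ 3 ℕ.+ n ℕ.+ 3
    six = ℕSolver.solve-∀

  vanish₁ : ∀ {L p} → ∣ L ∣ ≡ 2 ℕ.+ n → p ∉ L → S (insert L p) ≈ 0ℤ
  vanish₁ {L} ∣L∣≡ p∉L = vanish _ (trans (∣insert∣ L p∉L) (cong suc ∣L∣≡))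

  vanish₂ : ∀ {L p q} → ∣ L ∣ ≡ 1 ℕ.+ n → p ∉ L → q ∉ L → q ≢ p → S (insert (insert L p) q) ≈ 0ℤ
  vanish₂ {L} ∣L∣≡ p∉L q∉L q≢p = vanish₁ (trans (∣insert∣ L p∉L) (cong suc ∣L∣≡)) (∉-insert q∉L q≢p)

  module CrossDifference (m∤k-2 : ¬ m ∣ suc n) {a b c d : Fin v}
    (a≢b : a ≢ b) (a≢c : a ≢ c) (a≢d : a ≢ d) (b≢c : b ≢ c) (b≢d : b ≢ d) (c≢d : c ≢ d) where

    excluded : List (Fin v)
    excluded = a ∷ b ∷ c ∷ d ∷ []

    H : Subset v → ℤ
    H L = (Δ c (Δ a S) L - Δ c (Δ b S) L) - (Δ d (Δ a S) L - Δ d (Δ b S) L)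

    h : Fin v → ℤ
    h x = (W x c a - W x c b) - (W x d a - W x d b)

    ΔH : ∀ L x → Avoids excluded L → x ∉ L → x ∉ₗ excluded → Δ x H L ≡ h x
    ΔH L x (a∉L ∷ b∉L ∷ c∉L ∷ d∉L ∷ []) x∉L x∉ =
      trans (regroup (Δ c (Δ a S) (insert L x)) (Δ c (Δ b S) (insert L x))
                     (Δ d (Δ a S) (insert L x)) (Δ d (Δ b S) (insert L x))
                     (Δ c (Δ a S) L) (Δ c (Δ b S) L) (Δ d (Δ a S) L) (Δ d (Δ b S) L))
            (cong₂ _-_ (cong₂ _-_ (Δ³S x∉L c∉L a∉L (x≢c , x≢a , a≢c ∘ sym))
                                  (Δ³S x∉L c∉L b∉L (x≢c , x≢b , b≢c ∘ sym)))
                       (cong₂ _-_ (Δ³S x∉L d∉L a∉L (x≢d , x≢a , a≢d ∘ sym))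
                                  (Δ³S x∉L d∉L b∉L (x≢d , x≢b , b≢d ∘ sym))))
      where
      x≢a : x ≢ a
      x≢a = x∉ ∘ here
      x≢b : x ≢ b
      x≢b = x∉ ∘ there ∘ here
      x≢c : x ≢ c
      x≢c = x∉ ∘ there ∘ there ∘ here
      x≢d : x ≢ d
      x≢d = x∉ ∘ there ∘ there ∘ there ∘ here
      regroup : ∀ p₁ q₁ r₁ s₁ p₀ q₀ r₀ s₀ →
        ((p₁ - q₁) - (r₁ - s₁)) - ((p₀ - q₀) - (r₀ - s₀)) ≡ ((p₁ - p₀) - (q₁ - q₀)) - ((r₁ - r₀) - (s₁ - s₀))
      regroup = solve-∀

    H-∅ : H ∅ ≡ 0ℤ
    H-∅ rewrite ΔΔS-∅ c a | ΔΔS-∅ c b | ΔΔS-∅ d a | ΔΔS-∅ d b = refl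

    H-vanishes : ∀ L → Avoids excluded L → ∣ L ∣ ≡ 1 ℕ.+ n → H L ≈ 0ℤ
    H-vanishes L (a∉L ∷ b∉L ∷ c∉L ∷ d∉L ∷ []) ∣L∣≡ = begin
      H L
        ≡⟨ telescope (S (insert (insert L c) a)) (S (insert L c)) (S (insert L a)) (S L) (S (insert (insert L c) b))
                     (S (insert L b)) (S (insert (insert L d) a)) (S (insert L d)) (S (insert (insert L d) b)) ⟩
      (S (insert (insert L c) a) - S (insert (insert L c) b)) - (S (insert (insert L d) a) - S (insert (insert L d) b))
        ≈⟨ sub-cong (sub-cong (vanish₂ ∣L∣≡ c∉L a∉L a≢c) (vanish₂ ∣L∣≡ c∉L b∉L b≢c))
                    (sub-cong (vanish₂ ∣L∣≡ d∉L a∉L a≢d) (vanish₂ ∣L∣≡ d∉L b∉L b≢d)) ⟩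
      0ℤ ∎
      where
      open ≈-Reasoning
      telescope : ∀ Sca Sc Sa S₀ Scb Sb Sda Sd Sdb →
        (((Sca - Sc) - (Sa - S₀)) - ((Scb - Sc) - (Sb - S₀))) - (((Sda - Sd) - (Sa - S₀)) - ((Sdb - Sd) - (Sb - S₀)))
        ≡ (Sca - Scb) - (Sda - Sdb)
      telescope = solve-∀

    h-constant : ∀ {x y} → x ∉ₗ excluded → y ∉ₗ excluded → h x ≈ h y
    h-constant {x} {y} x∉ y∉ with pick-subset (x ∷ y ∷ excluded) 0 ℕ.≤-refl
    ... | M , ∣M∣≡ , x∉M ∷ y∉M ∷ M∩excluded = ≈-from-difference (begin
      h x - h y                          ≡⟨ cong₂ _-_ (ΔH M x M∩excluded x∉M x∉) (ΔH M y M∩excluded y∉M y∉) ⟨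
      Δ x H M - Δ y H M                  ≡⟨ cancel-middle (H (insert M x)) (H (insert M y)) (H M) ⟩
      H (insert M x) - H (insert M y)    ≈⟨ sub-cong (H-vanishes _ (avoids-insert M∩excluded x∉) (size x∉M))
                                                     (H-vanishes _ (avoids-insert M∩excluded y∉) (size y∉M)) ⟩
      0ℤ                                 ∎)
      where
      open ≈-Reasoning
      cancel-middle : ∀ p q r → (p - r) - (q - r) ≡ p - q
      cancel-middle = solve-∀
      size : ∀ {z} → z ∉ M → ∣ insert M z ∣ ≡ 1 ℕ.+ n
      size z∉M = trans (∣insert∣ M z∉M) (cong suc ∣M∣≡)

    cross-difference : ∀ {x} → x ∉ₗ excluded → h x ≈ 0ℤ
    cross-difference {x} x∉ =
      let (L , ∣L∣≡ , L∩excluded) = pick-subset excluded 1 (ℕ.n≤1+n 5)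
      in cancel {N = suc n} {h x} m-prime m∤k-2 (subst (λ k → + k * h x ≈ 0ℤ) (trans (nC1≡n ∣ L ∣) ∣L∣≡)
           (≈-trans (≈-sym (H-linear L L∩excluded)) (H-vanishes L L∩excluded ∣L∣≡)))
      where
      H-linear : ∀ L → Avoids excluded L → H L ≈ + (∣ L ∣ C 1) * h x
      H-linear = accumulate H excluded 0 (h x) H-∅ λ K y K∩excluded y∉K y∉ →
        ≈-trans (≡⇒≈ (ΔH K y K∩excluded y∉K y∉))
                (≈-trans (h-constant y∉ x∉) (≡⇒≈ (sym (ℤ.*-identityˡ (h x)))))

  module ThirdCoordinate (m∤k-2 : ¬ m ∣ suc n) (m∤C[k-1,2] : ¬ m ∣ (2 ℕ.+ n) C 2)
    {a b : Fin v} (a≢b : a ≢ b) where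

    excluded : List (Fin v)
    excluded = a ∷ b ∷ []

    D : Fin v → Fin v → ℤ
    D p q = W p q a - W p q b

    D-sym : ∀ p q → D p q ≡ D q p
    D-sym p q = cong₂ _-_ (W-swap₁₂ p q a) (W-swap₁₂ p q b)

    D-step : ∀ {p q r} → p ∉ₗ excluded → q ∉ₗ excluded → r ∉ₗ excluded → p ≢ q → p ≢ r → D p q ≈ D p r
    D-step {p} {q} {r} p∉ q∉ r∉ p≢q p≢r with q ≟ r
    ... | yes refl = ≈-refl
    ... | no q≢r = ≈-from-difference (CrossDifference.cross-difference m∤k-2 a≢b
      (q∉ ∘ here ∘ sym) (r∉ ∘ here ∘ sym) (q∉ ∘ there ∘ here ∘ sym) (r∉ ∘ there ∘ here ∘ sym) q≢r p∉abqr)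
      where
      p∉abqr : p ∉ₗ a ∷ b ∷ q ∷ r ∷ []
      p∉abqr (here p≡a) = p∉ (here p≡a)
      p∉abqr (there (here p≡b)) = p∉ (there (here p≡b))
      p∉abqr (there (there (here p≡q))) = p≢q p≡q
      p∉abqr (there (there (there (here p≡r)))) = p≢r p≡r

    D-constant : ∀ {p q p₀ q₀} → p ∉ₗ excluded → q ∉ₗ excluded → p₀ ∉ₗ excluded → q₀ ∉ₗ excluded →
      p ≢ q → p₀ ≢ q₀ → D p q ≈ D p₀ q₀
    D-constant {p} {q} {p₀} {q₀} p∉ q∉ p₀∉ q₀∉ p≢q p₀≢q₀ with p₀ ≟ q
    ... | yes refl = ≈-trans (≡⇒≈ (D-sym p q)) (D-step q∉ p∉ q₀∉ (p≢q ∘ sym) p₀≢q₀)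
    ... | no p₀≢q = begin
      D p q   ≡⟨ D-sym p q ⟩
      D q p   ≈⟨ D-step q∉ p∉ p₀∉ (p≢q ∘ sym) (p₀≢q ∘ sym) ⟩
      D q p₀  ≡⟨ D-sym q p₀ ⟩
      D p₀ q  ≈⟨ D-step p₀∉ q∉ q₀∉ p₀≢q p₀≢q₀ ⟩
      D p₀ q₀ ∎
      where open ≈-Reasoning

    G : Subset v → ℤ
    G L = Δ a S L - Δ b S L

    ΔΔG : ∀ {y} → y ∉ₗ excluded → ∀ L x → Avoids (y ∷ excluded) L → x ∉ L → x ∉ₗ y ∷ excluded →
      Δ x (Δ y G) L ≡ D x y
    ΔΔG {y} y∉ L x (y∉L ∷ a∉L ∷ b∉L ∷ []) x∉L x∉ =
      trans (Δ-cong x (Δ-sub (Δ a S) (Δ b S) y) L)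
      (trans (Δ-sub (Δ y (Δ a S)) (Δ y (Δ b S)) x L)
             (cong₂ _-_ (Δ³S x∉L y∉L a∉L (x∉ ∘ here , x∉ ∘ there ∘ here , y∉ ∘ here))
                        (Δ³S x∉L y∉L b∉L (x∉ ∘ here , x∉ ∘ there ∘ there ∘ here , y∉ ∘ there ∘ here))))

    ΔG-∅ : ∀ y → Δ y G ∅ ≡ 0ℤ
    ΔG-∅ y = trans (Δ-sub (Δ a S) (Δ b S) y ∅) (cong₂ _-_ (ΔΔS-∅ y a) (ΔΔS-∅ y b))

    G-∅ : G ∅ ≡ 0ℤ
    G-∅ = cong₂ _-_ (ΔS-∅ a) (ΔS-∅ b)

    G-vanishes : ∀ L → Avoids excluded L → ∣ L ∣ ≡ 2 ℕ.+ n → G L ≈ 0ℤ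
    G-vanishes L (a∉L ∷ b∉L ∷ []) ∣L∣≡ =
      ≈-trans (≡⇒≈ (cancel-middle (S (insert L a)) (S (insert L b)) (S L)))
              (sub-cong (vanish₁ ∣L∣≡ a∉L) (vanish₁ ∣L∣≡ b∉L))
      where
      cancel-middle : ∀ p q r → (p - r) - (q - r) ≡ p - q
      cancel-middle = solve-∀

    D-vanishes : ∀ {x₀ c₀} → x₀ ∉ₗ excluded → c₀ ∉ₗ excluded → x₀ ≢ c₀ → D x₀ c₀ ≈ 0ℤ
    D-vanishes {x₀} {c₀} x₀∉ c₀∉ x₀≢c₀ =
      let (L , ∣L∣≡ , L∩excluded) = pick-subset excluded 2 (ℕ.m≤m+n 4 2)
      in cancel {N = (2 ℕ.+ n) C 2} {D₀} m-prime m∤C[k-1,2] (subst (λ k → + (k C 2) * D₀ ≈ 0ℤ) ∣L∣≡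
           (≈-trans (≈-sym (G-quadratic L L∩excluded)) (G-vanishes L L∩excluded ∣L∣≡)))
      where
      D₀ : ℤ
      D₀ = D x₀ c₀
      ΔG-linear : ∀ {y} → y ∉ₗ excluded → ∀ L → Avoids (y ∷ excluded) L → Δ y G L ≈ + (∣ L ∣ C 1) * D₀
      ΔG-linear {y} y∉ = accumulate (Δ y G) (y ∷ excluded) 0 D₀ (ΔG-∅ y) λ K x K∩ x∉K x∉ →
        ≈-trans (≡⇒≈ (ΔΔG y∉ K x K∩ x∉K x∉))
                (≈-trans (D-constant (x∉ ∘ there) y∉ x₀∉ c₀∉ (x∉ ∘ here) x₀≢c₀) (≡⇒≈ (sym (ℤ.*-identityˡ D₀))))
      G-quadratic : ∀ L → Avoids excluded L → G L ≈ + (∣ L ∣ C 2) * D₀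
      G-quadratic = accumulate G excluded 1 D₀ G-∅ λ K y K∩excluded y∉K y∉ →
        ΔG-linear y∉ K (y∉K ∷ K∩excluded)

  module _ (m∤k-2 : ¬ m ∣ suc n) (m∤C[k-1,2] : ¬ m ∣ (2 ℕ.+ n) C 2) where

    W-third-coordinate : ∀ {x c a b} → Distinct x c a → Distinct x c b → a ≢ b → W x c a ≈ W x c b
    W-third-coordinate {x} {c} {a} {b} (x≢c , x≢a , c≢a) (_ , x≢b , c≢b) a≢b =
      ≈-from-difference (ThirdCoordinate.D-vanishes m∤k-2 m∤C[k-1,2] a≢b (off x≢a x≢b) (off c≢a c≢b) x≢c)
      where
      off : ∀ {y} → y ≢ a → y ≢ b → y ∉ₗ a ∷ b ∷ []
      off y≢a y≢b (here y≡a) = y≢a y≡a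
      off y≢a y≢b (there (here y≡b)) = y≢b y≡b

    private
      replace₃ : ∀ {p q r r′} → Distinct p q r → Distinct p q r′ → W p q r ≈ W p q r′
      replace₃ {r = r} {r′} pqr pqr′ with r ≟ r′
      ... | yes refl = ≈-refl
      ... | no r≢r′ = W-third-coordinate pqr pqr′ r≢r′

      move-first : ∀ {p q r} p₀ → Distinct p q r → ∃ λ q₁ → ∃ λ r₁ → Distinct p₀ q₁ r₁ × W p q r ≈ W p₀ q₁ r₁
      move-first {p} {q} {r} p₀ (p≢q , p≢r , q≢r) with p₀ ≟ p | p₀ ≟ q | p₀ ≟ r
      ... | yes refl | _ | _ = q , r , (p≢q , p≢r , q≢r) , ≈-refl
      ... | no _ | yes refl | _ = p , r , (p≢q ∘ sym , q≢r , p≢r) , ≡⇒≈ (W-swap₁₂ p q r)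
      ... | no _ | no _ | yes refl =
            p , q , (p≢r ∘ sym , q≢r ∘ sym , p≢q) , ≡⇒≈ (trans (W-swap₂₃ p q r) (W-swap₁₂ p r q))
      ... | no p₀≢p | no p₀≢q | no p₀≢r = q , r , (p₀≢q , p₀≢r , q≢r) , (begin
            W p q r   ≡⟨ trans (W-swap₁₂ p q r) (W-swap₂₃ q p r) ⟩
            W q r p   ≈⟨ replace₃ (q≢r , p≢q ∘ sym , p≢r ∘ sym) (q≢r , p₀≢q ∘ sym , p₀≢r ∘ sym) ⟩
            W q r p₀  ≡⟨ trans (W-swap₂₃ q r p₀) (W-swap₁₂ q p₀ r) ⟩
            W p₀ q r  ∎)
        where open ≈-Reasoning

      move-second : ∀ {p q r} q₀ → Distinct p q r → p ≢ q₀ → ∃ λ r₂ → Distinct p q₀ r₂ × W p q r ≈ W p q₀ r₂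
      move-second {p} {q} {r} q₀ (p≢q , p≢r , q≢r) p≢q₀ with q₀ ≟ q | q₀ ≟ r
      ... | yes refl | _ = r , (p≢q , p≢r , q≢r) , ≈-refl
      ... | no _ | yes refl = q , (p≢r , p≢q , q≢r ∘ sym) , ≡⇒≈ (W-swap₂₃ p q r)
      ... | no q₀≢q | no q₀≢r = r , (p≢q₀ , p≢r , q₀≢r) , (begin
            W p q r   ≡⟨ W-swap₂₃ p q r ⟩
            W p r q   ≈⟨ replace₃ (p≢r , p≢q , q≢r ∘ sym) (p≢r , p≢q₀ , q₀≢r ∘ sym) ⟩
            W p r q₀  ≡⟨ W-swap₂₃ p r q₀ ⟩
            W p q₀ r  ∎)
        where open ≈-Reasoning

    W-constant : ∀ {p q r p₀ q₀ r₀} → Distinct p q r → Distinct p₀ q₀ r₀ → W p q r ≈ W p₀ q₀ r₀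
    W-constant {p₀ = p₀} {q₀} {r₀} pqr p₀q₀r₀@(p₀≢q₀ , _ , _) =
      let (q₁ , r₁ , p₀q₁r₁ , W₁) = move-first p₀ pqr
          (r₂ , p₀q₀r₂ , W₂) = move-second q₀ p₀q₁r₁ p₀≢q₀
      in ≈-trans W₁ (≈-trans W₂ (replace₃ p₀q₀r₂ p₀q₀r₀))

    W-vanishes : ¬ m ∣ (3 ℕ.+ n) C 3 → ∀ {α β γ} → Distinct α β γ → W α β γ ≈ 0ℤ
    W-vanishes m∤C[k,3] {α} {β} {γ} αβγ =
      let (L , ∣L∣≡ , _) = pick-subset [] 3 (ℕ.m≤m+n 3 3)
      in cancel {N = (3 ℕ.+ n) C 3} {c₀} m-prime m∤C[k,3] (subst (λ k → + (k C 3) * c₀ ≈ 0ℤ) ∣L∣≡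
           (≈-trans (≈-sym (S-cubic L [])) (vanish L ∣L∣≡)))
      where
      c₀ : ℤ
      c₀ = W α β γ
      ΔΔS-linear : ∀ {c a} → c ≢ a → ∀ L → Avoids (c ∷ a ∷ []) L → Δ c (Δ a S) L ≈ + (∣ L ∣ C 1) * c₀
      ΔΔS-linear {c} {a} c≢a = accumulate (Δ c (Δ a S)) (c ∷ a ∷ []) 0 c₀ (ΔΔS-∅ c a)
        λ { K x (c∉K ∷ a∉K ∷ []) x∉K x∉ → let xca = (x∉ ∘ here , x∉ ∘ there ∘ here , c≢a) in
              ≈-trans (≡⇒≈ (Δ³S x∉K c∉K a∉K xca))
                      (≈-trans (W-constant xca αβγ) (≡⇒≈ (sym (ℤ.*-identityˡ c₀)))) }
      ΔS-quadratic : ∀ a L → Avoids (a ∷ []) L → Δ a S L ≈ + (∣ L ∣ C 2) * c₀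
      ΔS-quadratic a = accumulate (Δ a S) (a ∷ []) 1 c₀ (ΔS-∅ a)
        λ K c K∩ c∉K c∉ → ΔΔS-linear (c∉ ∘ here) K (c∉K ∷ K∩)
      S-cubic : ∀ L → Avoids [] L → S L ≈ + (∣ L ∣ C 3) * c₀
      S-cubic = accumulate S [] 2 c₀ S-∅ λ K a _ a∉K _ → ΔS-quadratic a K (a∉K ∷ [])

-- Tournaments

c3-as-sum : (U : Tournament v) (K : Subset v) → + c3 U K ≡ Σ₃ (λ x y z → χ³ K x y z * 𝟙 (cyclic U x y z))
c3-as-sum {v} U K =
  trans (length-filter _ (triples v))
  (trans (ΣL-triples {v} _)
         (Σ₃-cong (λ x y z → 𝟙 (inS K x ∧ inS K y ∧ inS K z ∧ cyclic U x y z))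
                  (λ x y z → χ³ K x y z * 𝟙 (cyclic U x y z))
           λ x y z _ _ → trans (𝟙-∧ (inS K x) _)
                         (trans (cong (χ K x *_) (trans (𝟙-∧ (inS K y) _) (cong (χ K y *_) (𝟙-∧ (inS K z) _))))
                                (reassociate (χ K x) (χ K y) (χ K z) (𝟙 (cyclic U x y z))))))
  where
  reassociate : ∀ a b c d → a * (b * (c * d)) ≡ a * b * c * d
  reassociate = solve-∀

∧-rotate : ∀ p q r → p ∧ (q ∧ r) ≡ q ∧ (r ∧ p)
∧-rotate p q r = trans (Bool.∧-comm p (q ∧ r)) (Bool.∧-assoc q r p)

cyclic-swap₁₂ : (U : Tournament v) (x y z : Fin v) → cyclic U x y z ≡ cyclic U y x z
cyclic-swap₁₂ U x y z =
  trans (cong₂ _∨_ (∧-rotate (arc U x y) (arc U y z) (arc U z x))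
                   (trans (∧-rotate (arc U x z) (arc U z y) (arc U y x)) (∧-rotate (arc U z y) (arc U y x) (arc U x z))))
        (Bool.∨-comm (arc U y z ∧ (arc U z x ∧ arc U x y)) (arc U y x ∧ (arc U x z ∧ arc U z y)))

cyclic-swap₂₃ : (U : Tournament v) (x y z : Fin v) → cyclic U x y z ≡ cyclic U x z y
cyclic-swap₂₃ U x y z = Bool.∨-comm (arc U x y ∧ (arc U y z ∧ arc U z x)) (arc U x z ∧ (arc U z y ∧ arc U y x))

threeCycle : Bool → Bool → Bool → Bool
threeCycle p q r = (p ∧ (q ∧ not r)) ∨ (r ∧ (not q ∧ not p))

cyclic-via-arcs : (U : Tournament v) {x y z : Fin v} → Distinct x y z →
  cyclic U x y z ≡ threeCycle (arc U x y) (arc U y z) (arc U x z)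
cyclic-via-arcs U {x} {y} {z} (x≢y , x≢z , y≢z)
  rewrite total U x z x≢z | total U y z y≢z | total U x y x≢y = refl

cyclic-split : (U : Tournament v) {x y z : Fin v} → Distinct x y z → cyclic U x y z ≡ true →
  arc U x y ≡ not (arc U x z)
cyclic-split U {x} {y} {z} xyz cyc = split (arc U x y) (arc U y z) (arc U x z) (trans (sym (cyclic-via-arcs U xyz)) cyc)
  where
  split : ∀ p q r → threeCycle p q r ≡ true → p ≡ not r
  split true  _     false _ = refl
  split false _     true  _ = refl
  split true  true  true  ()
  split true  false true  ()
  split false true  false ()
  split false false false ()

-- A vertex of a cyclic triangle has one out-neighbour in it; three such triangles at α in a
-- 4-set would make α's three arcs pairwise opposite.
no-three-triangles-at : (U : Tournament v) {α β γ ω : Fin v} → α ≢ β → α ≢ γ → α ≢ ω → β ≢ γ → β ≢ ω → γ ≢ ω →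
  cyclic U α β γ ≡ true → cyclic U α β ω ≡ true → cyclic U α γ ω ≡ true → ⊥
no-three-triangles-at U α≢β α≢γ α≢ω β≢γ β≢ω γ≢ω αβγ αβω αγω =
  pairwise-opposite (cyclic-split U (α≢β , α≢γ , β≢γ) αβγ) (cyclic-split U (α≢β , α≢ω , β≢ω) αβω)
                    (cyclic-split U (α≢γ , α≢ω , γ≢ω) αγω)
  where
  pairwise-opposite : ∀ {a b c : Bool} → a ≡ not b → a ≡ not c → b ≡ not c → ⊥
  pairwise-opposite {b = true}  {true}  _    _  ()
  pairwise-opposite {b = false} {false} _    _  ()
  pairwise-opposite {b = true}  {false} refl () _
  pairwise-opposite {b = false} {true}  refl () _

-- For such m, distinct values in {-1, 0, 1} are incongruent modulo m.
Large : ℕ → Set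
Large m = m ≡ 0 ⊎ 3 ≤ m

module _ {m : ℕ} (large : Large m) where
  open Modulo m

  private
    small-∤ : ∀ {i} → + m ∣ℤ i → 0 ℕ.< ℤ.∣ i ∣ → ℤ.∣ i ∣ ≤ 2 → ⊥
    small-∤ {i} m∣i 0<∣i∣ ∣i∣≤2 = excluded large (ℤ∣.∣⇒∣ᵤ m∣i)
      where
      excluded : Large m → m ∣ ℤ.∣ i ∣ → ⊥
      excluded (inj₁ refl) 0∣∣i∣ = ℕ.<⇒≢ 0<∣i∣ (sym (ℕ∣.0∣⇒≡0 0∣∣i∣))
      excluded (inj₂ 3≤m) m∣∣i∣ =
        ℕ.<-irrefl refl (ℕ.≤-trans 3≤m (ℕ.≤-trans (ℕ∣.∣⇒≤ {{ℕ.>-nonZero 0<∣i∣}} m∣∣i∣) ∣i∣≤2))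

  unit-congruence : ∀ p q p₀ q₀ → p₀ ≢ q₀ → 𝟙 p - 𝟙 q ≈ 𝟙 p₀ - 𝟙 q₀ → p ≡ p₀ × q ≡ q₀
  unit-congruence true  false true  false _ _ = refl , refl
  unit-congruence false true  false true  _ _ = refl , refl
  unit-congruence true  true  true  false _ (mod m∣) = ⊥-elim (small-∤ m∣ (s≤s z≤n) (s≤s z≤n))
  unit-congruence false false true  false _ (mod m∣) = ⊥-elim (small-∤ m∣ (s≤s z≤n) (s≤s z≤n))
  unit-congruence false true  true  false _ (mod m∣) = ⊥-elim (small-∤ m∣ (s≤s z≤n) ℕ.≤-refl)
  unit-congruence true  true  false true  _ (mod m∣) = ⊥-elim (small-∤ m∣ (s≤s z≤n) (s≤s z≤n))
  unit-congruence false false false true  _ (mod m∣) = ⊥-elim (small-∤ m∣ (s≤s z≤n) (s≤s z≤n))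
  unit-congruence true  false false true  _ (mod m∣) = ⊥-elim (small-∤ m∣ (s≤s z≤n) ℕ.≤-refl)
  unit-congruence _     _     true  true  p₀≢q₀ _ = contradiction refl p₀≢q₀
  unit-congruence _     _     false false p₀≢q₀ _ = contradiction refl p₀≢q₀

parity-congruence : ∀ p q → Modulo._≈_ 2 (𝟙 p - 𝟙 q) 0ℤ → p ≡ q
parity-congruence true  true  _ = refl
parity-congruence false false _ = refl
parity-congruence true  false (Modulo.mod 2∣1) with ℕ∣.∣⇒≤ (ℤ∣.∣⇒∣ᵤ 2∣1)
... | s≤s ()
parity-congruence false true  (Modulo.mod 2∣-1) with ℕ∣.∣⇒≤ (ℤ∣.∣⇒∣ᵤ 2∣-1)
... | s≤s ()

AgreeOnTriangles : Tournament v → Tournament v → Set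
AgreeOnTriangles {v} T T′ = ∀ {x y z : Fin v} → Distinct x y z → cyclic T x y z ≡ cyclic T′ x y z

module Triangles {v : ℕ} (T T′ : Tournament v) where

  cycleDiff : Fin v → Fin v → Fin v → ℤ
  cycleDiff x y z = 𝟙 (cyclic T x y z) - 𝟙 (cyclic T′ x y z)

  open CubicSetFunction cycleDiff public

  c3-difference : ∀ K → + c3 T K - + c3 T′ K ≡ S K
  c3-difference K =
    trans (cong₂ _-_ (c3-as-sum T K) (c3-as-sum T′ K))
    (trans (sym (Σ₃-distrib-- (λ x y z → χ³ K x y z * 𝟙 (cyclic T x y z))
                              (λ x y z → χ³ K x y z * 𝟙 (cyclic T′ x y z))))
           (Σ₃-cong _ _ λ x y z _ _ → *-distribˡ-- (χ³ K x y z) (𝟙 (cyclic T x y z)) (𝟙 (cyclic T′ x y z))))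
    where
    *-distribˡ-- : ∀ a b c → a * b - a * c ≡ a * (b - c)
    *-distribˡ-- = solve-∀

  W≡cycleDiff : ∀ {x y z} → Distinct x y z → W x y z ≡ cycleDiff x y z
  W≡cycleDiff = W≡w
    (λ x y z → cong₂ (λ p q → 𝟙 p - 𝟙 q) (cyclic-swap₁₂ T x y z) (cyclic-swap₁₂ T′ x y z))
    (λ x y z → cong₂ (λ p q → 𝟙 p - 𝟙 q) (cyclic-swap₂₃ T x y z) (cyclic-swap₂₃ T′ x y z))

  -- If T and T′ disagree on αβγ, the congruences make them disagree in the same way on αβω and
  -- αγω, so α lies on three cyclic triangles of one of them.
  agree-large : ∀ {m} → Large m → 4 ≤ v →
    (∀ {x c a b} → Distinct x c a → Distinct x c b → a ≢ b → Modulo._≈_ m (W x c a) (W x c b)) →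
    AgreeOnTriangles T T′
  agree-large {m} large 4≤v third {α} {β} {γ} αβγ@(α≢β , α≢γ , β≢γ)
    with cyclic T α β γ Bool.≟ cyclic T′ α β γ
  ... | yes agree = agree
  ... | no disagree = ⊥-elim (three-triangles (one-holds disagree))
    where
    open Modulo m
    fresh-ω : ∃ λ x → x ∉ ∅ × x ∉ₗ α ∷ β ∷ γ ∷ []
    fresh-ω = fresh (α ∷ β ∷ γ ∷ []) ∅ (subst (λ k → k ℕ.+ 3 ℕ.< v) (sym (∣⊥∣≡0 v)) 4≤v)
    ω : Fin v
    ω = proj₁ fresh-ω
    ω∉ : ω ∉ₗ α ∷ β ∷ γ ∷ []
    ω∉ = proj₂ (proj₂ fresh-ω)
    α≢ω : α ≢ ω
    α≢ω = ω∉ ∘ here ∘ sym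
    β≢ω : β ≢ ω
    β≢ω = ω∉ ∘ there ∘ here ∘ sym
    γ≢ω : γ ≢ ω
    γ≢ω = ω∉ ∘ there ∘ there ∘ here ∘ sym
    αβω : cycleDiff α β ω ≈ cycleDiff α β γ
    αβω = subst₂ _≈_ (W≡cycleDiff (α≢β , α≢ω , β≢ω)) (W≡cycleDiff αβγ)
                     (third (α≢β , α≢ω , β≢ω) αβγ (γ≢ω ∘ sym))
    αγω : cycleDiff α γ ω ≈ cycleDiff α β γ
    αγω = subst₂ _≈_ (W≡cycleDiff (α≢γ , α≢ω , γ≢ω)) (trans (sym (W-swap₂₃ α β γ)) (W≡cycleDiff αβγ))
                     (third (α≢γ , α≢ω , γ≢ω) (α≢γ , α≢β , β≢γ ∘ sym) (β≢ω ∘ sym))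
    same-αβω : cyclic T α β ω ≡ cyclic T α β γ × cyclic T′ α β ω ≡ cyclic T′ α β γ
    same-αβω = unit-congruence large (cyclic T α β ω) (cyclic T′ α β ω) (cyclic T α β γ) (cyclic T′ α β γ)
                               disagree αβω
    same-αγω : cyclic T α γ ω ≡ cyclic T α β γ × cyclic T′ α γ ω ≡ cyclic T′ α β γ
    same-αγω = unit-congruence large (cyclic T α γ ω) (cyclic T′ α γ ω) (cyclic T α β γ) (cyclic T′ α β γ)
                               disagree αγω
    one-holds : ∀ {p q : Bool} → p ≢ q → p ≡ true ⊎ q ≡ true
    one-holds {true} _ = inj₁ refl
    one-holds {false} {true} _ = inj₂ refl
    one-holds {false} {false} p≢q = contradiction refl p≢q
    three-triangles : cyclic T α β γ ≡ true ⊎ cyclic T′ α β γ ≡ true → ⊥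
    three-triangles (inj₁ c) =
      no-three-triangles-at T α≢β α≢γ α≢ω β≢γ β≢ω γ≢ω c
        (trans (proj₁ same-αβω) c) (trans (proj₁ same-αγω) c)
    three-triangles (inj₂ c′) =
      no-three-triangles-at T′ α≢β α≢γ α≢ω β≢γ β≢ω γ≢ω c′
        (trans (proj₂ same-αβω) c′) (trans (proj₂ same-αγω) c′)

  agree-parity : (∀ {x y z} → Distinct x y z → Modulo._≈_ 2 (W x y z) 0ℤ) → AgreeOnTriangles T T′
  agree-parity W≈0 xyz = parity-congruence _ _ (subst (λ a → Modulo._≈_ 2 a 0ℤ) (W≡cycleDiff xyz) (W≈0 xyz))

-- Isomorphisms of induced subtournaments of size at most 3

record Enumeration {v : ℕ} (h : ℕ) (K : Subset v) : Set where
  field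
    elem : Fin h → Fin v
    elem-injective : ∀ i j → elem i ≡ elem j → i ≡ j
    elem-∈ : ∀ i → elem i ∈ K
    elem-onto : ∀ {z} → z ∈ K → ∃ λ i → elem i ≡ z

enumerate : (h : ℕ) (K : Subset v) → ∣ K ∣ ≡ h → Enumeration h K
enumerate zero K ∣K∣≡0 = record
  { elem = λ ()
  ; elem-injective = λ ()
  ; elem-∈ = λ ()
  ; elem-onto = λ z∈K → contradiction (subst (_ ∈_) (∣p∣≡0⇒p≡∅ K ∣K∣≡0) z∈K) ∉⊥
  }
enumerate {v} (suc h) K ∣K∣≡ = extend (remove-one K ∣K∣≡)
  where
  extend : (∃ λ x → x ∈ K × ∣ K ∖ x ∣ ≡ h) → Enumeration (suc h) K
  extend (x , x∈K , ∣K∖x∣≡h) = record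
    { elem = elem
    ; elem-injective = injective
    ; elem-∈ = λ { zero → x∈K ; (suc i) → p─q⊆p K _ (E.elem-∈ i) }
    ; elem-onto = onto
    }
    where
    module E = Enumeration (enumerate h (K ∖ x) ∣K∖x∣≡h)
    elem : Fin (suc h) → Fin v
    elem zero = x
    elem (suc i) = E.elem i
    E-elem≢x : ∀ i → E.elem i ≢ x
    E-elem≢x i e = x∉p∖x K x (subst (_∈ K ∖ x) e (E.elem-∈ i))
    injective : ∀ i j → elem i ≡ elem j → i ≡ j
    injective zero zero _ = refl
    injective zero (suc j) x≡ = contradiction (sym x≡) (E-elem≢x j)
    injective (suc i) zero ≡x = contradiction ≡x (E-elem≢x i)
    injective (suc i) (suc j) e = cong suc (E.elem-injective i j e)
    onto : ∀ {z} → z ∈ K → ∃ λ i → elem i ≡ z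
    onto {z} z∈K with z ≟ x
    ... | yes refl = zero , refl
    ... | no z≢x = let (i , e) = E.elem-onto (x∈p∧x≢y⇒x∈p-y z∈K z≢x) in suc i , e

module _ {h : ℕ} {K : Subset v} (E : Enumeration h K) where
  open Enumeration E

  elem-≢ : ∀ i j → i ≢ j → elem i ≢ elem j
  elem-≢ i j i≢j = i≢j ∘ elem-injective i j

  CanonicalForm : Tournament v → (Fin h → Fin h → Bool) → Set
  CanonicalForm U C = Σ (Permutation′ h) λ τ → ∀ i j → arc U (elem (τ ⟨$⟩ʳ i)) (elem (τ ⟨$⟩ʳ j)) ≡ C i j

  canonical-form : (U : Tournament v) {A C : Fin h → Fin h → Bool} → (∀ i j → arc U (elem i) (elem j) ≡ A i j) →
    (Σ (Permutation′ h) λ τ → ∀ i j → A (τ ⟨$⟩ʳ i) (τ ⟨$⟩ʳ j) ≡ C i j) → CanonicalForm U C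
  canonical-form U U≡A (τ , A≅C) = τ , λ i j → trans (U≡A (τ ⟨$⟩ʳ i) (τ ⟨$⟩ʳ j)) (A≅C i j)

module _ {h : ℕ} (T T′ : Tournament v) {K : Subset v} (E : Enumeration h K) where
  open Enumeration E

  induced-iso : (σ : Fin h → Fin h) → (∀ i j → σ i ≡ σ j → i ≡ j) →
    (∀ i j → arc T (elem i) (elem j) ≡ arc T′ (elem (σ i)) (elem (σ j))) → InducedIso T T′ K
  induced-iso σ σ-injective arcs = f , maps-into , injective-on , preserves
    where
    f : Fin v → Fin v
    f z with any? (λ i → elem i ≟ z)
    ... | yes (i , _) = elem (σ i)
    ... | no _ = z
    f-elem : ∀ i → f (elem i) ≡ elem (σ i)
    f-elem i with any? (λ j → elem j ≟ elem i)
    ... | yes (j , e) = cong (elem ∘ σ) (elem-injective j i e)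
    ... | no ∄ = contradiction (i , refl) ∄
    maps-into : ∀ x → x ∈ K → f x ∈ K
    maps-into x x∈K with elem-onto x∈K
    ... | i , refl = subst (_∈ K) (sym (f-elem i)) (elem-∈ (σ i))
    injective-on : ∀ x y → x ∈ K → y ∈ K → f x ≡ f y → x ≡ y
    injective-on x y x∈K y∈K fx≡fy with elem-onto x∈K | elem-onto y∈K
    ... | i , refl | j , refl =
      cong elem (σ-injective i j (elem-injective (σ i) (σ j) (trans (sym (f-elem i)) (trans fx≡fy (f-elem j)))))
    preserves : ∀ x y → x ∈ K → y ∈ K → arc T x y ≡ arc T′ (f x) (f y)
    preserves x y x∈K y∈K with elem-onto x∈K | elem-onto y∈K
    ... | i , refl | j , refl = trans (arcs i j) (sym (cong₂ (arc T′) (f-elem i) (f-elem j)))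

  iso-via-canonical : ∀ {C} → CanonicalForm E T C → CanonicalForm E T′ C → InducedIso T T′ K
  iso-via-canonical {C} (τ , T≅C) (τ′ , T′≅C) = induced-iso σ σ-injective arcs
    where
    σ : Fin h → Fin h
    σ i = τ′ ⟨$⟩ʳ (τ ⟨$⟩ˡ i)
    σ-injective : ∀ i j → σ i ≡ σ j → i ≡ j
    σ-injective i j σi≡σj = begin
      i                       ≡⟨ inverseʳ τ ⟨
      τ ⟨$⟩ʳ (τ ⟨$⟩ˡ i)       ≡⟨ cong (τ ⟨$⟩ʳ_) (inverseˡ τ′) ⟨
      τ ⟨$⟩ʳ (τ′ ⟨$⟩ˡ σ i)    ≡⟨ cong (λ k → τ ⟨$⟩ʳ (τ′ ⟨$⟩ˡ k)) σi≡σj ⟩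
      τ ⟨$⟩ʳ (τ′ ⟨$⟩ˡ σ j)    ≡⟨ cong (τ ⟨$⟩ʳ_) (inverseˡ τ′) ⟩
      τ ⟨$⟩ʳ (τ ⟨$⟩ˡ j)       ≡⟨ inverseʳ τ ⟩
      j                       ∎
      where open ≡-Reasoning
    arcs : ∀ i j → arc T (elem i) (elem j) ≡ arc T′ (elem (σ i)) (elem (σ j))
    arcs i j = begin
      arc T (elem i) (elem j)
        ≡⟨ cong₂ (λ a b → arc T (elem a) (elem b)) (inverseʳ τ) (inverseʳ τ) ⟨
      arc T (elem (τ ⟨$⟩ʳ (τ ⟨$⟩ˡ i))) (elem (τ ⟨$⟩ʳ (τ ⟨$⟩ˡ j)))
        ≡⟨ T≅C (τ ⟨$⟩ˡ i) (τ ⟨$⟩ˡ j) ⟩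
      C (τ ⟨$⟩ˡ i) (τ ⟨$⟩ˡ j)
        ≡⟨ T′≅C (τ ⟨$⟩ˡ i) (τ ⟨$⟩ˡ j) ⟨
      arc T′ (elem (σ i)) (elem (σ j))
        ∎
      where open ≡-Reasoning

by-decision : ∀ {h} (A B : Fin h → Fin h → Bool) → {True (all? λ i → all? λ j → A i j Bool.≟ B i j)} →
  ∀ i j → A i j ≡ B i j
by-decision A B {ok} = toWitness ok

table₂ : Bool → Fin 2 → Fin 2 → Bool
table₂ p 0F 1F = p
table₂ p 1F 0F = not p
table₂ p 0F 0F = false
table₂ p 1F 1F = false

table₂-canonical : ∀ p → Σ (Permutation′ 2) λ τ → ∀ i j → table₂ p (τ ⟨$⟩ʳ i) (τ ⟨$⟩ʳ j) ≡ table₂ true i j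
table₂-canonical true = idₚ , by-decision _ _
table₂-canonical false = transpose 0F 1F , by-decision _ _

table₃ : Bool → Bool → Bool → Fin 3 → Fin 3 → Bool
table₃ p q r 0F 1F = p
table₃ p q r 1F 2F = q
table₃ p q r 0F 2F = r
table₃ p q r 1F 0F = not p
table₃ p q r 2F 1F = not q
table₃ p q r 2F 0F = not r
table₃ p q r 0F 0F = false
table₃ p q r 1F 1F = false
table₃ p q r 2F 2F = false

canonical₃ : Bool → Fin 3 → Fin 3 → Bool
canonical₃ true = table₃ true true false
canonical₃ false = table₃ true true true

table₃-canonical : ∀ p q r →
  Σ (Permutation′ 3) λ τ → ∀ i j → table₃ p q r (τ ⟨$⟩ʳ i) (τ ⟨$⟩ʳ j) ≡ canonical₃ (threeCycle p q r) i j
table₃-canonical true  true  true  = idₚ , by-decision _ _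
table₃-canonical true  true  false = idₚ , by-decision _ _
table₃-canonical true  false true  = transpose 1F 2F , by-decision _ _
table₃-canonical false true  true  = transpose 0F 1F , by-decision _ _
table₃-canonical false false true  = transpose 1F 2F , by-decision _ _
table₃-canonical false false false = transpose 0F 2F , by-decision _ _
table₃-canonical false true  false = transpose 0F 1F ∘ₚ transpose 0F 2F , by-decision _ _
table₃-canonical true  false false = transpose 0F 2F ∘ₚ transpose 0F 1F , by-decision _ _

module _ (U : Tournament v) where

  arc-table₂ : (g : Fin 2 → Fin v) → g 0F ≢ g 1F → ∀ i j → arc U (g i) (g j) ≡ table₂ (arc U (g 0F) (g 1F)) i j
  arc-table₂ g g₀≢g₁ 0F 1F = refl
  arc-table₂ g g₀≢g₁ 1F 0F = total U _ _ g₀≢g₁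
  arc-table₂ g g₀≢g₁ 0F 0F = irrefl U _
  arc-table₂ g g₀≢g₁ 1F 1F = irrefl U _

  arc-table₃ : (g : Fin 3 → Fin v) → Distinct (g 0F) (g 1F) (g 2F) →
    ∀ i j → arc U (g i) (g j) ≡ table₃ (arc U (g 0F) (g 1F)) (arc U (g 1F) (g 2F)) (arc U (g 0F) (g 2F)) i j
  arc-table₃ g _ 0F 1F = refl
  arc-table₃ g _ 1F 2F = refl
  arc-table₃ g _ 0F 2F = refl
  arc-table₃ g (g₀≢g₁ , _ , _) 1F 0F = total U _ _ g₀≢g₁
  arc-table₃ g (_ , _ , g₁≢g₂) 2F 1F = total U _ _ g₁≢g₂
  arc-table₃ g (_ , g₀≢g₂ , _) 2F 0F = total U _ _ g₀≢g₂
  arc-table₃ g _ 0F 0F = irrefl U _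
  arc-table₃ g _ 1F 1F = irrefl U _
  arc-table₃ g _ 2F 2F = irrefl U _

agree⇒hypomorphic : (T T′ : Tournament v) → AgreeOnTriangles T T′ → HypomorphicLe 3 T T′
agree⇒hypomorphic T T′ agree 0 _ K ∣K∣≡ =
  iso-via-canonical T T′ (enumerate 0 K ∣K∣≡) {λ _ _ → false} (idₚ , λ ()) (idₚ , λ ())
agree⇒hypomorphic T T′ agree 1 _ K ∣K∣≡ =
  iso-via-canonical T T′ (enumerate 1 K ∣K∣≡) {λ _ _ → false}
    (idₚ , λ { 0F 0F → irrefl T _ }) (idₚ , λ { 0F 0F → irrefl T′ _ })
agree⇒hypomorphic T T′ agree 2 _ K ∣K∣≡ = iso-via-canonical T T′ E (form T) (form T′)
  where
  E : Enumeration 2 K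
  E = enumerate 2 K ∣K∣≡
  open Enumeration E
  form : ∀ U → CanonicalForm E U (table₂ true)
  form U = canonical-form E U (arc-table₂ U elem (elem-≢ E 0F 1F λ ())) (table₂-canonical (arc U (elem 0F) (elem 1F)))
agree⇒hypomorphic T T′ agree 3 _ K ∣K∣≡ =
  iso-via-canonical T T′ E (subst (CanonicalForm E T ∘ canonical₃) (agree distinct) (form T)) (form T′)
  where
  E : Enumeration 3 K
  E = enumerate 3 K ∣K∣≡
  open Enumeration E
  distinct : Distinct (elem 0F) (elem 1F) (elem 2F)
  distinct = elem-≢ E 0F 1F (λ ()) , elem-≢ E 0F 2F (λ ()) , elem-≢ E 1F 2F (λ ())
  form : ∀ U → CanonicalForm E U (canonical₃ (cyclic U (elem 0F) (elem 1F) (elem 2F)))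
  form U = subst (CanonicalForm E U ∘ canonical₃) (sym (cyclic-via-arcs U distinct))
    (canonical-form E U (arc-table₃ U elem distinct)
      (table₃-canonical (arc U (elem 0F) (elem 1F)) (arc U (elem 1F) (elem 2F)) (arc U (elem 0F) (elem 2F))))
agree⇒hypomorphic T T′ agree (suc (suc (suc (suc h)))) (s≤s (s≤s (s≤s ()))) K ∣K∣≡

-- Arithmetic of the moduli

prime-modulus : ∀ {p} → Prime p → PrimeModulus p
prime-modulus p-prime {a} {b} = euclidsLemma a b p-prime

zero-modulus : PrimeModulus 0
zero-modulus {a} 0∣ab with ℕ.m*n≡0⇒m≡0∨n≡0 a (ℕ∣.0∣⇒≡0 0∣ab)
... | inj₁ refl = inj₁ (0 ℕ∣.∣0)
... | inj₂ refl = inj₂ (0 ℕ∣.∣0)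

0∤suc : ∀ {j} → ¬ 0 ∣ suc j
0∤suc 0∣ = contradiction (ℕ∣.0∣⇒≡0 0∣) λ ()

odd-∤ : ∀ r → ¬ 2 ∣ suc (2 ℕ.* r)
odd-∤ r 2∣ =
  contradiction (ℕ∣.∣1⇒≡1 (ℕ∣.∣m+n∣m⇒∣n (subst (2 ∣_) (ℕ.+-comm 1 (2 ℕ.* r)) 2∣) (ℕ∣.m∣m*n r))) λ ()

2*C2 : ∀ n → 2 ℕ.* (suc n C 2) ≡ suc n ℕ.* n
2*C2 zero = refl
2*C2 (suc n) = begin
  2 ℕ.* (suc (suc n) C 2)             ≡⟨ cong (2 ℕ.*_) (nCk+nC[k+1]≡[n+1]C[k+1] (suc n) 1) ⟨
  2 ℕ.* (suc n C 1 ℕ.+ suc n C 2)     ≡⟨ cong (λ c → 2 ℕ.* (c ℕ.+ suc n C 2)) (nC1≡n (suc n)) ⟩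
  2 ℕ.* (suc n ℕ.+ suc n C 2)         ≡⟨ ℕ.*-distribˡ-+ 2 (suc n) (suc n C 2) ⟩
  2 ℕ.* suc n ℕ.+ 2 ℕ.* (suc n C 2)   ≡⟨ cong (2 ℕ.* suc n ℕ.+_) (2*C2 n) ⟩
  2 ℕ.* suc n ℕ.+ suc n ℕ.* n         ≡⟨ factor n ⟩
  suc (suc n) ℕ.* suc n               ∎
  where
  open ≡-Reasoning
  factor : ∀ n → 2 ℕ.* (1 ℕ.+ n) ℕ.+ (1 ℕ.+ n) ℕ.* n ≡ (2 ℕ.+ n) ℕ.* (1 ℕ.+ n)
  factor = ℕSolver.solve-∀

6*C3 : ∀ n → 6 ℕ.* (suc (suc n) C 3) ≡ suc (suc n) ℕ.* suc n ℕ.* n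
6*C3 zero = refl
6*C3 (suc n) = begin
  6 ℕ.* (suc (suc (suc n)) C 3)
    ≡⟨ cong (6 ℕ.*_) (nCk+nC[k+1]≡[n+1]C[k+1] (suc (suc n)) 2) ⟨
  6 ℕ.* (suc (suc n) C 2 ℕ.+ suc (suc n) C 3)
    ≡⟨ distribute (suc (suc n) C 2) (suc (suc n) C 3) ⟩
  3 ℕ.* (2 ℕ.* (suc (suc n) C 2)) ℕ.+ 6 ℕ.* (suc (suc n) C 3)
    ≡⟨ cong₂ (λ a b → 3 ℕ.* a ℕ.+ b) (2*C2 (suc n)) (6*C3 n) ⟩
  3 ℕ.* (suc (suc n) ℕ.* suc n) ℕ.+ suc (suc n) ℕ.* suc n ℕ.* n
    ≡⟨ factor n ⟩
  suc (suc (suc n)) ℕ.* suc (suc n) ℕ.* suc n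
    ∎
  where
  open ≡-Reasoning
  distribute : ∀ a b → 6 ℕ.* (a ℕ.+ b) ≡ 3 ℕ.* (2 ℕ.* a) ℕ.+ 6 ℕ.* b
  distribute = ℕSolver.solve-∀
  factor : ∀ n → 3 ℕ.* ((2 ℕ.+ n) ℕ.* (1 ℕ.+ n)) ℕ.+ (2 ℕ.+ n) ℕ.* (1 ℕ.+ n) ℕ.* n
               ≡ (3 ℕ.+ n) ℕ.* (2 ℕ.+ n) ℕ.* (1 ℕ.+ n)
  factor = ℕSolver.solve-∀

∤-C2 : ∀ {m} n → PrimeModulus m → ¬ m ∣ suc n → ¬ m ∣ suc (suc n) → ¬ m ∣ (2 ℕ.+ n) C 2
∤-C2 {m} n m-prime m∤n+1 m∤n+2 m∣C =
  ∤-* m-prime m∤n+2 m∤n+1 (subst (m ∣_) (2*C2 (suc n)) (ℕ∣.∣n⇒∣m*n 2 m∣C))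

odd-k-2 : ∀ q → ¬ 2 ∣ suc (q ℕ.* 4)
odd-k-2 q = subst (λ a → ¬ 2 ∣ a) (shape q) (odd-∤ (q ℕ.* 2))
  where
  shape : ∀ q → 1 ℕ.+ 2 ℕ.* (q ℕ.* 2) ≡ 1 ℕ.+ q ℕ.* 4
  shape = ℕSolver.solve-∀

odd-C[k-1,2] : ∀ q → ¬ 2 ∣ (2 ℕ.+ q ℕ.* 4) C 2
odd-C[k-1,2] q 2∣C = ∤-* (prime-modulus prime[2]) (odd-∤ q) (odd-∤ (2 ℕ.* q))
  (subst (2 ∣_) (ℕ.*-cancelˡ-≡ _ _ 2 (trans (2*C2 (suc (q ℕ.* 4))) (halve q))) 2∣C)
  where
  halve : ∀ q → (2 ℕ.+ q ℕ.* 4) ℕ.* (1 ℕ.+ q ℕ.* 4) ≡ 2 ℕ.* ((1 ℕ.+ 2 ℕ.* q) ℕ.* (1 ℕ.+ 2 ℕ.* (2 ℕ.* q)))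
  halve = ℕSolver.solve-∀

odd-C[k,3] : ∀ q → ¬ 2 ∣ (3 ℕ.+ q ℕ.* 4) C 3
odd-C[k,3] q 2∣C = ∤-* 2-prime (∤-* 2-prime (odd-∤ (suc (2 ℕ.* q))) (odd-∤ q)) (odd-∤ (2 ℕ.* q))
  (subst (2 ∣_) (ℕ.*-cancelˡ-≡ _ _ 2
                  (trans (reassociate ((3 ℕ.+ q ℕ.* 4) C 3)) (trans (6*C3 (suc (q ℕ.* 4))) (halve q))))
    (ℕ∣.∣n⇒∣m*n 3 2∣C))
  where
  2-prime : PrimeModulus 2
  2-prime = prime-modulus prime[2]
  reassociate : ∀ c → 2 ℕ.* (3 ℕ.* c) ≡ 6 ℕ.* c
  reassociate = ℕSolver.solve-∀
  halve : ∀ q → (3 ℕ.+ q ℕ.* 4) ℕ.* (2 ℕ.+ q ℕ.* 4) ℕ.* (1 ℕ.+ q ℕ.* 4)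
              ≡ 2 ℕ.* ((1 ℕ.+ 2 ℕ.* (1 ℕ.+ 2 ℕ.* q)) ℕ.* (1 ℕ.+ 2 ℕ.* q) ℕ.* (1 ℕ.+ 2 ℕ.* (2 ℕ.* q)))
  halve = ℕSolver.solve-∀

multiple-of-3 : ∀ {n} → 3 ∣ 3 ℕ.+ n → (¬ 3 ∣ suc n) × (¬ 3 ∣ suc (suc n))
multiple-of-3 {n} 3∣k = (λ 3∣ → excluded (shifted 1 3∣) (s≤s z≤n)) , (λ 3∣ → excluded (shifted 2 3∣) ℕ.≤-refl)
  where
  3∣n : 3 ∣ n
  3∣n = ℕ∣.∣m+n∣m⇒∣n 3∣k ℕ∣.∣-refl
  shifted : ∀ j → 3 ∣ j ℕ.+ n → 3 ∣ j
  shifted j 3∣j+n = ℕ∣.∣m+n∣m⇒∣n (subst (3 ∣_) (ℕ.+-comm j n) 3∣j+n) 3∣n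
  excluded : ∀ {j} → 3 ∣ suc j → suc j ≤ 2 → ⊥
  excluded 3∣ ≤2 = ℕ.<-irrefl refl (ℕ.≤-trans (ℕ∣.∣⇒≤ 3∣) ≤2)

exact⇒congruent : ∀ {a b} m → a ≡ b → a ≡ b [mod m ]
exact⇒congruent {a} m refl = subst (λ i → m ∣ ℤ.∣ i ∣) (sym (ℤ.+-inverseʳ (+ a))) (m ℕ∣.∣0)

module _ (T T′ : Tournament v) where
  open Triangles T T′

  c3-congruent⇒S≈0 : ∀ {m k} → (∀ (K : Subset v) → ∣ K ∣ ≡ k → c3 T K ≡ c3 T′ K [mod m ]) →
    ∀ K → ∣ K ∣ ≡ k → Modulo._≈_ m (S K) 0ℤ
  c3-congruent⇒S≈0 {m} congruent K ∣K∣≡k =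
    Modulo.∣⇒≈0 m (subst (+ m ∣ℤ_) (c3-difference K) (ℤ∣.∣ᵤ⇒∣ (congruent K ∣K∣≡k)))

  hypomorphic-large : ∀ {m n} → PrimeModulus m → Large m → ¬ m ∣ suc n → ¬ m ∣ (2 ℕ.+ n) C 2 → 3 ℕ.+ n ℕ.+ 3 ≤ v →
    (∀ (K : Subset v) → ∣ K ∣ ≡ 3 ℕ.+ n → c3 T K ≡ c3 T′ K [mod m ]) → HypomorphicLe 3 T T′
  hypomorphic-large {m} {n} m-prime large m∤k-2 m∤C[k-1,2] room congruent =
    agree⇒hypomorphic T T′ (agree-large large 4≤v
      (Vanishing.W-third-coordinate cycleDiff m-prime n room (c3-congruent⇒S≈0 congruent) m∤k-2 m∤C[k-1,2]))
    where
    4≤v : 4 ≤ v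
    4≤v = ℕ.≤-trans (s≤s (s≤s (s≤s (ℕ.≤-trans (s≤s z≤n) (ℕ.m≤n+m 3 n))))) room

  hypomorphic-parity : ∀ {n} → ¬ 2 ∣ suc n → ¬ 2 ∣ (2 ℕ.+ n) C 2 → ¬ 2 ∣ (3 ℕ.+ n) C 3 → 3 ℕ.+ n ℕ.+ 3 ≤ v →
    (∀ (K : Subset v) → ∣ K ∣ ≡ 3 ℕ.+ n → c3 T K ≡ c3 T′ K [mod 2 ]) → HypomorphicLe 3 T T′
  hypomorphic-parity {n} 2∤k-2 2∤C[k-1,2] 2∤C[k,3] room congruent =
    agree⇒hypomorphic T T′ (agree-parity
      (Vanishing.W-vanishes cycleDiff (prime-modulus prime[2]) n room (c3-congruent⇒S≈0 congruent)
        2∤k-2 2∤C[k-1,2] 2∤C[k,3]))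

theorem5p2 : (v : ℕ) (T T' : Tournament v) (p k : ℕ) → Prime p → 3 ≤ k → k ℕ.+ 3 ≤ v →
    ((∀ (K : Subset v) → ∣ K ∣ ≡ k → c3 T K ≡ c3 T' K) → HypomorphicLe 3 T T')
    × ((5 ≤ p → ¬ (k ≡ 1 [mod p ]) → ¬ (k ≡ 2 [mod p ]) →
        (∀ (K : Subset v) → ∣ K ∣ ≡ k → c3 T K ≡ c3 T' K [mod p ]) → HypomorphicLe 3 T T')
    × ((((p ≡ 2) × (k ≡ 3 [mod 4 ])) ⊎ ((p ≡ 3) × (3 ∣ k))) →
        (∀ (K : Subset v) → ∣ K ∣ ≡ k → c3 T K ≡ c3 T' K [mod p ]) → HypomorphicLe 3 T T'))
theorem5p2 v T T' p (suc (suc (suc n))) p-prime (s≤s (s≤s (s≤s z≤n))) room =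
    (λ equal → hypomorphic-large T T' zero-modulus (inj₁ refl) 0∤suc (∤-C2 n zero-modulus 0∤suc 0∤suc) room
                 λ K ∣K∣≡k → exact⇒congruent 0 (equal K ∣K∣≡k))
  , (λ 5≤p k≢1 k≢2 → hypomorphic-large T T' (prime-modulus p-prime) (inj₂ (ℕ.≤-trans (ℕ.m≤m+n 3 2) 5≤p)) k≢2
                        (∤-C2 n (prime-modulus p-prime) k≢2 k≢1) room)
  , λ { (inj₁ (refl , divides q refl)) → hypomorphic-parity T T' (odd-k-2 q) (odd-C[k-1,2] q) (odd-C[k,3] q) room
      ; (inj₂ (refl , 3∣k)) → let (3∤k-2 , 3∤k-1) = multiple-of-3 3∣k in
          hypomorphic-large T T' (prime-modulus p-prime) (inj₂ ℕ.≤-refl) 3∤k-2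
                            (∤-C2 n (prime-modulus p-prime) 3∤k-2 3∤k-1) room }
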